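{- Let $\phi$ be a \textsc{3Sat} instance with variables $x_1,\dots,x_N$ and clauses $C_1,\dots,C_M$, in which every clause involves exactly $3$ distinct variables and every variable appears in exactly $d$ clauses. Suppose that $\omega(G_\phi)\le 1-\epsilon$ and $k,\ell\le\sqrt{\epsilon N}/4$ for some absolute constant $\epsilon>0$ (with $k,\ell\ge1$). Then $\omega(G_\phi^{k\times\ell})\le 1-\Omega(k\ell/N)$.
   Context: Two-prover game: $G=(X,Y,A,B,\mathcal{D},V)$ with finite question sets $X,Y$, answer sets $A,B$, distribution $\mathcal{D}$ on $X\times Y$, $V:X\times Y\times A\times B\to[0,1]$; value $\omega(G)=\max_{a:X\to A,b:Y\to B}\mathbb{E}_{(x,y)\sim\mathcal{D}}[V(x,y,a(x),b(y))]$. The clause/variable game $G_\phi$: the verifier picks $i\in[M]$ uniformly, then $j$ uniformly among indices of variables occurring in $C_i$; prover 1 receives $i$ and answers an assignment to the variables of $C_i$; prover 2 receives $j$ and answers a bit for $x_j$; the verifier accepts iff prover 1's assignment satisfies $C_i$ and agrees with prover 2's bit on $x_j$. Thus $\mathcal{D}$ is uniform on $Z=\{(i,j):x_j\text{ occurs in }C_i\}$ and $V\in\{0,1\}$. Birthday repetition $G^{k\times\ell}$ of such a game: the verifier picks independent uniformly random $S\subseteq X$, $|S|=k$, and $T\subseteq Y$, $|T|=\ell$, sends $S$ to prover 1 (answer $a:S\to A$) and $T$ to prover 2 (answer $b:T\to B$), and accepts iff $V(x,y,a(x),b(y))=1$ for all $(x,y)\in(S\times T)\cap Z$ (always accepting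 if the intersection is empty); its value is the maximum acceptance probability over prover strategies. -}

module Defs where

open import Data.Bool using (Bool; true; false; _∧_; _∨_; if_then_else_)
import Data.Bool as B
open import Data.Nat using (ℕ; zero; suc; _≡ᵇ_)
open import Data.Fin using (Fin)
import Data.Fin as F
open import Data.Fin.Subset using (Subset; ∣_∣)
open import Data.Vec using (Vec; []; _∷_; lookup)
open import Data.List using (List; []; _∷_; map; _++_; length; filterᵇ; allFin; cartesianProduct)
open import Data.Bool.ListAction using (all; any)
open import Data.Product using (_×_; _,_; proj₁; proj₂)
open import Data.Integer using (+_)
open import Data.Rational using (ℚ; _/_; 0ℚ)
open import Relation.Nullary.Decidable using (⌊_⌋)

count : {A : Set} → (A → Bool) → List A → ℕ
count p xs = length (filterᵇ p xs)

-- the rational number a / t (t is always positive where used;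
-- the value for t = 0 is an irrelevant convention)
ratio : ℕ → ℕ → ℚ
ratio a zero    = 0ℚ
ratio a (suc t) = (+ a) / suc t

toℚ : ℕ → ℚ
toℚ n = (+ n) / 1

allSubsets : (n : ℕ) → List (Subset n)
allSubsets zero    = [] ∷ []
allSubsets (suc n) = map (true ∷_) (allSubsets n) ++ map (false ∷_) (allSubsets n)

subsetsOfSize : (n k : ℕ) → List (Subset n)
subsetsOfSize n k = filterᵇ (λ S → ∣ S ∣ ≡ᵇ k) (allSubsets n)

_∈ᵇ_ : {n : ℕ} → Fin n → Subset n → Bool
i ∈ᵇ S = lookup S i

_==ᵇ_ : Bool → Bool → Bool
a ==ᵇ b = ⌊ a B.≟ b ⌋

-- a literal: a variable index together with its polarity
-- (true = positive literal x_j, false = negated literal ¬x_j)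
record Literal (N : ℕ) : Set where
  constructor lit
  field
    var : Fin N
    pos : Bool
open Literal public

Clause : ℕ → Set
Clause N = Fin 3 → Literal N

Formula : ℕ → ℕ → Set
Formula N M = Fin M → Clause N

DistinctVars : {N M : ℕ} → Formula N M → Set
DistinctVars {N} {M} φ = (i : Fin M) (p q : Fin 3) → var (φ i p) ≡ var (φ i q) → p ≡ q
  where open import Relation.Binary.PropositionalEquality using (_≡_)

occurs : {N M : ℕ} → Formula N M → Fin M → Fin N → Bool
occurs φ i j = any (λ p → ⌊ var (φ i p) F.≟ j ⌋) (allFin 3)

Regular : {N M : ℕ} → Formula N M → ℕ → Set
Regular {N} {M} φ d = (j : Fin N) → count (λ i → occurs φ i j) (allFin M) ≡ d
  where open import Relation.Binary.PropositionalEquality using (_≡_)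

-- prover 1's answer to clause i: an assignment to the variables of C_i,
-- given position-wise (value of the variable at position p of C_i)
ClauseAssignment : Set
ClauseAssignment = Fin 3 → Bool

satisfies : {N : ℕ} → Clause N → ClauseAssignment → Bool
satisfies C a = any (λ p → a p ==ᵇ pos (C p)) (allFin 3)

-- the verifier predicate V on a question pair (i, j) ∈ Z, where j is the
-- variable at position p of C_i: accept iff prover 1's assignment satisfies
-- C_i and agrees with prover 2's bit b on x_j
Vφ : {N M : ℕ} → Formula N M → Fin M → Fin 3 → ClauseAssignment → Bool → Bool
Vφ φ i p a b = satisfies (φ i) a ∧ (a p ==ᵇ b)

Strategy₁ : ℕ → Set
Strategy₁ M = Fin M → ClauseAssignment

Strategy₂ : ℕ → Set
Strategy₂ N = Fin N → Bool

-- D is uniform on Z = {(i,j) : x_j occurs in C_i}; since each clause has 3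
-- distinct variables, Z is in bijection with Fin M × Fin 3 via
-- (i , p) ↦ (i , var (φ i p)), and "i uniform, then j uniform among the
-- variables of C_i" is exactly the uniform distribution on Fin M × Fin 3.
accProb : {N M : ℕ} → Formula N M → Strategy₁ M → Strategy₂ N → ℚ
accProb {N} {M} φ a b =
  ratio (count (λ ip → Vφ φ (proj₁ ip) (proj₂ ip) (a (proj₁ ip)) (b (var (φ (proj₁ ip) (proj₂ ip)))))
               (cartesianProduct (allFin M) (allFin 3)))
        (length (cartesianProduct (allFin M) (allFin 3)))

-- prover 1 receives S ⊆ [M], |S| = k, and answers an assignment for each
-- clause in S (values for clauses outside S are never looked at)
BStrategy₁ : ℕ → Set
BStrategy₁ M = Subset M → Fin M → ClauseAssignment

-- prover 2 receives T ⊆ [N], |T| = ℓ, and answers a bit for each variable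
-- of T (values outside T are never looked at)
BStrategy₂ : ℕ → Set
BStrategy₂ N = Subset N → Fin N → Bool

bAccepts : {N M : ℕ} → Formula N M → BStrategy₁ M → BStrategy₂ N →
           Subset M → Subset N → Bool
bAccepts {N} {M} φ a b S T =
  all (λ i → if i ∈ᵇ S
             then all (λ p → if var (φ i p) ∈ᵇ T
                             then Vφ φ i p (a S i) (b T (var (φ i p)))
                             else true)
                      (allFin 3)
             else true)
      (allFin M)

bAccProb : {N M : ℕ} → Formula N M → (k ℓ : ℕ) → BStrategy₁ M → BStrategy₂ N → ℚ
bAccProb {N} {M} φ k ℓ a b =
  ratio (count (λ ST → bAccepts φ a b (proj₁ ST) (proj₂ ST)) pairs) (length pairs)
  where
    pairs = cartesianProduct (subsetsOfSize M k) (subsetsOfSize N ℓ)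

module Submission where

-- Proof (second-moment method).  Fix strategies for G_φ^{k×ℓ}.  An edge (i, p)
-- (the p-th variable of clause i) is queried on questions (S, T) when i ∈ S and
-- its variable lies in T.  With Y the number of queried and X the number of
-- violated edges, 2X + Y ≤ 2·[reject] + Y² pointwise.  Summing over all (S, T):
--   * first moment: ∑Y = 3M·a₁b₁, where a₁ (b₁) counts the k- (ℓ-)subsets
--     through a given clause (variable);
--   * rounding: answering every clause and variable by its best answer gives
--     strategies for G_φ, hence ∑X ≥ ε·∑Y;
--   * second moment: ∑Y² ≤ ∑Y + collisions, and by regularity (Nd = 3M) and
--     the size bounds the collisions are at most (9/16)·ε·∑Y.
-- So the number of rejections is at least (23/32)·ε·∑Y, and ∑Y is 3kℓ/N times
-- the number of question pairs.

module FiniteSums where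

  open import Data.Bool using (Bool; true; false)
  open import Data.Nat using (ℕ; zero; suc; _+_; _*_; _≤_; z≤n; _≤?_)
  open import Data.Nat.Properties
  open import Data.Nat.Tactic.RingSolver using (solve-∀)
  open import Data.Fin using (Fin)
  import Data.Fin as F
  import Data.Fin.Properties as FP
  open import Data.List using (List; []; _∷_; map; _++_; length; filterᵇ; allFin; cartesianProduct)
  open import Data.List.Properties using (map-tabulate)
  open import Data.Bool.ListAction using (all)
  open import Data.Product using (Σ; _×_; _,_)
  open import Data.Empty using (⊥-elim)
  open import Relation.Nullary.Decidable using (⌊_⌋; yes; no)
  open import Relation.Binary.PropositionalEquality
  open import Defs using (count)

  ∑ : {A : Set} → List A → (A → ℕ) → ℕ
  ∑ []       f = 0
  ∑ (x ∷ xs) f = f x + ∑ xs f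

  syntax ∑ xs (λ x → e) = ∑[ x ∈ xs ] e

  𝟙 : Bool → ℕ
  𝟙 true  = 1
  𝟙 false = 0

  𝟙-idem : (b : Bool) → 𝟙 b * 𝟙 b ≡ 𝟙 b
  𝟙-idem true  = refl
  𝟙-idem false = refl

  δ : {n : ℕ} → Fin n → Fin n → ℕ
  δ x y = 𝟙 ⌊ x FP.≟ y ⌋

  private variable
    A B : Set

  ∑-cong : (xs : List A) {f g : A → ℕ} → (∀ x → f x ≡ g x) → ∑ xs f ≡ ∑ xs g
  ∑-cong []       f≡g = refl
  ∑-cong (x ∷ xs) f≡g = cong₂ _+_ (f≡g x) (∑-cong xs f≡g)

  ∑-mono : (xs : List A) {f g : A → ℕ} → (∀ x → f x ≤ g x) → ∑ xs f ≤ ∑ xs g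
  ∑-mono []       f≤g = z≤n
  ∑-mono (x ∷ xs) f≤g = +-mono-≤ (f≤g x) (∑-mono xs f≤g)

  ∑-++ : (xs ys : List A) (f : A → ℕ) → ∑ (xs ++ ys) f ≡ ∑ xs f + ∑ ys f
  ∑-++ []       ys f = refl
  ∑-++ (x ∷ xs) ys f = trans (cong (f x +_) (∑-++ xs ys f)) (sym (+-assoc (f x) _ _))

  ∑-map : (g : A → B) (xs : List A) (f : B → ℕ) → ∑ (map g xs) f ≡ ∑ xs (λ x → f (g x))
  ∑-map g []       f = refl
  ∑-map g (x ∷ xs) f = cong (f (g x) +_) (∑-map g xs f)

  ∑-+ : (xs : List A) (f g : A → ℕ) → ∑[ x ∈ xs ] (f x + g x) ≡ ∑ xs f + ∑ xs g
  ∑-+ []       f g = refl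
  ∑-+ (x ∷ xs) f g = trans (cong (f x + g x +_) (∑-+ xs f g)) (interchange (f x) (g x) _ _)
    where
    interchange : ∀ a b c d → a + b + (c + d) ≡ a + c + (b + d)
    interchange = solve-∀

  ∑-*ˡ : (c : ℕ) (xs : List A) (f : A → ℕ) → ∑[ x ∈ xs ] (c * f x) ≡ c * ∑ xs f
  ∑-*ˡ c []       f = sym (*-zeroʳ c)
  ∑-*ˡ c (x ∷ xs) f = trans (cong (c * f x +_) (∑-*ˡ c xs f)) (sym (*-distribˡ-+ c (f x) _))

  ∑-*ʳ : (c : ℕ) (xs : List A) (f : A → ℕ) → ∑[ x ∈ xs ] (f x * c) ≡ ∑ xs f * c
  ∑-*ʳ c xs f = trans (∑-cong xs (λ x → *-comm (f x) c)) (trans (∑-*ˡ c xs f) (*-comm c _))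

  ∑-const : (c : ℕ) (xs : List A) → ∑[ _ ∈ xs ] c ≡ length xs * c
  ∑-const c []       = refl
  ∑-const c (x ∷ xs) = cong (c +_) (∑-const c xs)

  ∑-zero : (xs : List A) → ∑[ _ ∈ xs ] 0 ≡ 0
  ∑-zero xs = trans (∑-const 0 xs) (*-zeroʳ (length xs))

  ∑-swap : (xs : List A) (ys : List B) (f : A → B → ℕ) →
           ∑[ x ∈ xs ] ∑[ y ∈ ys ] f x y ≡ ∑[ y ∈ ys ] ∑[ x ∈ xs ] f x y
  ∑-swap []       ys f = sym (∑-zero ys)
  ∑-swap (x ∷ xs) ys f =
    trans (cong (∑ ys (f x) +_) (∑-swap xs ys f)) (sym (∑-+ ys (f x) (λ y → ∑[ x ∈ xs ] f x y)))

  ∑-product : (xs : List A) (ys : List B) (f : A → ℕ) (g : B → ℕ) →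
              ∑[ x ∈ xs ] ∑[ y ∈ ys ] (f x * g y) ≡ ∑ xs f * ∑ ys g
  ∑-product xs ys f g = trans (∑-cong xs (λ x → ∑-*ˡ (f x) ys g)) (∑-*ʳ (∑ ys g) xs f)

  ∑-cartesian : (xs : List A) (ys : List B) (f : A × B → ℕ) →
                ∑ (cartesianProduct xs ys) f ≡ ∑[ x ∈ xs ] ∑[ y ∈ ys ] f (x , y)
  ∑-cartesian []       ys f = refl
  ∑-cartesian (x ∷ xs) ys f =
    trans (∑-++ (map (x ,_) ys) _ f) (cong₂ _+_ (∑-map (x ,_) ys f) (∑-cartesian xs ys f))

  length≡∑ : (xs : List A) → length xs ≡ ∑[ _ ∈ xs ] 1
  length≡∑ []       = refl
  length≡∑ (x ∷ xs) = cong suc (length≡∑ xs)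

  count≡∑ : (p : A → Bool) (xs : List A) → count p xs ≡ ∑[ x ∈ xs ] 𝟙 (p x)
  count≡∑ p []       = refl
  count≡∑ p (x ∷ xs) with p x
  ... | true  = cong suc (count≡∑ p xs)
  ... | false = count≡∑ p xs

  ∑-filter : (p : A → Bool) (xs : List A) (f : A → ℕ) →
             ∑ (filterᵇ p xs) f ≡ ∑[ x ∈ xs ] (𝟙 (p x) * f x)
  ∑-filter p []       f = refl
  ∑-filter p (x ∷ xs) f with p x
  ... | true  = cong₂ _+_ (sym (+-identityʳ (f x))) (∑-filter p xs f)
  ... | false = ∑-filter p xs f

  all⇒∑≡0 : (p : A → Bool) (f : A → ℕ) (xs : List A) →
            (∀ x → p x ≡ true → f x ≡ 0) → all p xs ≡ true → ∑ xs f ≡ 0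
  all⇒∑≡0 p f []       _   _   = refl
  all⇒∑≡0 p f (x ∷ xs) f≡0 all≡true with p x in px
  ... | true  = cong₂ _+_ (f≡0 x px) (all⇒∑≡0 p f xs f≡0 all≡true)

  ∑≤count*max : (xs : List A) (w : A → Bool) (h : A → ℕ) (x₀ : A) →
                Σ A (λ x* → ∑[ x ∈ xs ] (𝟙 (w x) * h x) ≤ ∑[ x ∈ xs ] 𝟙 (w x) * h x*)
  ∑≤count*max []       w h x₀ = x₀ , z≤n
  ∑≤count*max (x ∷ xs) w h x₀ with ∑≤count*max xs w h x₀ | w x
  ... | y , le | false = y , le
  ... | y , le | true with h x ≤? h y
  ...   | yes hx≤hy = y , +-mono-≤ (≤-trans (≤-reflexive (+-identityʳ (h x))) hx≤hy) le
  ...   | no  hx≰hy = x , +-mono-≤ (≤-reflexive (+-identityʳ (h x)))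
                              (≤-trans le (*-monoʳ-≤ (∑[ x ∈ xs ] 𝟙 (w x)) (<⇒≤ (≰⇒> hx≰hy))))

  ∑-allFin-suc : (n : ℕ) (f : Fin (suc n) → ℕ) → ∑ (allFin (suc n)) f ≡ f F.zero + ∑[ y ∈ allFin n ] f (F.suc y)
  ∑-allFin-suc n f = cong (f F.zero +_) (trans (cong (λ ys → ∑ ys f) (sym (map-tabulate (λ y → y) F.suc))) (∑-map F.suc (allFin n) f))

  δ-sym : {n : ℕ} (x y : Fin n) → δ x y ≡ δ y x
  δ-sym x y with x FP.≟ y | y FP.≟ x
  ... | yes _   | yes _   = refl
  ... | no _    | no _    = refl
  ... | yes x≡y | no y≢x  = ⊥-elim (y≢x (sym x≡y))
  ... | no x≢y  | yes y≡x = ⊥-elim (x≢y (sym y≡x))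

  δ-suc : {n : ℕ} (x y : Fin n) → δ (F.suc x) (F.suc y) ≡ δ x y
  δ-suc x y with x FP.≟ y
  ... | yes _ = refl
  ... | no _  = refl

  ∑-δ : (n : ℕ) (x : Fin n) (g : Fin n → ℕ) → ∑[ y ∈ allFin n ] (δ x y * g y) ≡ g x
  ∑-δ (suc n) F.zero g = begin
    ∑[ y ∈ allFin (suc n) ] (δ F.zero y * g y)         ≡⟨ ∑-allFin-suc n (λ y → δ F.zero y * g y) ⟩
    g F.zero + 0 + ∑[ y ∈ allFin n ] (0 * g (F.suc y)) ≡⟨ cong (g F.zero + 0 +_) (∑-zero (allFin n)) ⟩
    g F.zero + 0 + 0                                    ≡⟨ trans (+-identityʳ _) (+-identityʳ _) ⟩
    g F.zero                                            ∎
    where open ≡-Reasoning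
  ∑-δ (suc n) (F.suc x) g = begin
    ∑[ y ∈ allFin (suc n) ] (δ (F.suc x) y * g y)     ≡⟨ ∑-allFin-suc n (λ y → δ (F.suc x) y * g y) ⟩
    0 + ∑[ y ∈ allFin n ] (δ (F.suc x) (F.suc y) * g (F.suc y)) ≡⟨ ∑-cong (allFin n) (λ y → cong (_* g (F.suc y)) (δ-suc x y)) ⟩
    ∑[ y ∈ allFin n ] (δ x y * g (F.suc y))           ≡⟨ ∑-δ n x (λ y → g (F.suc y)) ⟩
    g (F.suc x) ∎
    where open ≡-Reasoning


module SubsetCounts where

  open import Data.Bool using (Bool; true; false)
  open import Data.Nat using (ℕ; zero; suc; _+_; _*_; _≤_; z≤n; _≡ᵇ_)
  open import Data.Nat.Properties
  open import Data.Nat.Combinatorics using (_C_; nC1≡n; nCk+nC[k+1]≡[n+1]C[k+1])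
  open import Data.Nat.Tactic.RingSolver using (solve-∀)
  open import Data.Fin using (Fin)
  import Data.Fin as F
  import Data.Fin.Properties as FP
  open import Relation.Nullary.Decidable using (yes; no)
  open import Data.Fin.Subset using (Subset; ∣_∣)
  open import Data.Vec using (_∷_)
  open import Data.List using (length; map)
  open import Data.Empty using (⊥-elim)
  open import Relation.Nullary using (¬_)
  open import Relation.Binary.PropositionalEquality
  open import Defs using (allSubsets; subsetsOfSize; _∈ᵇ_)
  open FiniteSums

  hasSize : {n : ℕ} → ℕ → Subset n → Bool
  hasSize k S = ∣ S ∣ ≡ᵇ k

  ∑-subsetsOfSize : (n k : ℕ) (f : Subset n → ℕ) →
    ∑ (subsetsOfSize n k) f ≡ ∑[ S ∈ allSubsets n ] (𝟙 (hasSize k S) * f S)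
  ∑-subsetsOfSize n k f = ∑-filter (hasSize k) (allSubsets n) f

  ∑-allSubsets-suc : (n : ℕ) (f : Subset (suc n) → ℕ) →
    ∑ (allSubsets (suc n)) f ≡ ∑[ S ∈ allSubsets n ] f (true ∷ S) + ∑[ S ∈ allSubsets n ] f (false ∷ S)
  ∑-allSubsets-suc n f = trans (∑-++ (map (true ∷_) (allSubsets n)) _ f)
    (cong₂ _+_ (∑-map (true ∷_) (allSubsets n) f) (∑-map (false ∷_) (allSubsets n) f))

  ∑-subsetsOfSize-suc₀ : (n : ℕ) (f : Subset (suc n) → ℕ) →
    ∑ (subsetsOfSize (suc n) 0) f ≡ ∑[ S ∈ subsetsOfSize n 0 ] f (false ∷ S)
  ∑-subsetsOfSize-suc₀ n f = begin
    ∑ (subsetsOfSize (suc n) 0) f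
      ≡⟨ ∑-subsetsOfSize (suc n) 0 f ⟩
    ∑[ S ∈ allSubsets (suc n) ] (𝟙 (hasSize 0 S) * f S)
      ≡⟨ ∑-allSubsets-suc n (λ S → 𝟙 (hasSize 0 S) * f S) ⟩
    ∑[ S ∈ allSubsets n ] 0 + ∑[ S ∈ allSubsets n ] (𝟙 (hasSize 0 S) * f (false ∷ S))
      ≡⟨ cong (_+ ∑[ S ∈ allSubsets n ] (𝟙 (hasSize 0 S) * f (false ∷ S))) (∑-zero (allSubsets n)) ⟩
    ∑[ S ∈ allSubsets n ] (𝟙 (hasSize 0 S) * f (false ∷ S))
      ≡⟨ ∑-subsetsOfSize n 0 (λ S → f (false ∷ S)) ⟨
    ∑[ S ∈ subsetsOfSize n 0 ] f (false ∷ S) ∎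
    where open ≡-Reasoning

  ∑-subsetsOfSize-suc : (n k : ℕ) (f : Subset (suc n) → ℕ) →
    ∑ (subsetsOfSize (suc n) (suc k)) f ≡
    ∑[ S ∈ subsetsOfSize n k ] f (true ∷ S) + ∑[ S ∈ subsetsOfSize n (suc k) ] f (false ∷ S)
  ∑-subsetsOfSize-suc n k f = begin
    ∑ (subsetsOfSize (suc n) (suc k)) f
      ≡⟨ ∑-subsetsOfSize (suc n) (suc k) f ⟩
    ∑[ S ∈ allSubsets (suc n) ] (𝟙 (hasSize (suc k) S) * f S)
      ≡⟨ ∑-allSubsets-suc n (λ S → 𝟙 (hasSize (suc k) S) * f S) ⟩
    ∑[ S ∈ allSubsets n ] (𝟙 (hasSize k S) * f (true ∷ S)) + ∑[ S ∈ allSubsets n ] (𝟙 (hasSize (suc k) S) * f (false ∷ S))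
      ≡⟨ cong₂ _+_ (∑-subsetsOfSize n k (λ S → f (true ∷ S))) (∑-subsetsOfSize n (suc k) (λ S → f (false ∷ S))) ⟨
    ∑[ S ∈ subsetsOfSize n k ] f (true ∷ S) + ∑[ S ∈ subsetsOfSize n (suc k) ] f (false ∷ S) ∎
    where open ≡-Reasoning

  -- The number of k-subsets of an n-set through one, resp. two, given points.
  through₁ : ℕ → ℕ → ℕ
  through₁ n       zero    = 0
  through₁ zero    (suc k) = 0
  through₁ (suc n) (suc k) = n C k

  through₂ : ℕ → ℕ → ℕ
  through₂ n             zero          = 0
  through₂ n             (suc zero)    = 0
  through₂ zero          (suc (suc k)) = 0
  through₂ (suc zero)    (suc (suc k)) = 0
  through₂ (suc (suc n)) (suc (suc k)) = n C k

  through₁-pascal : ∀ n k → through₁ (suc n) k + through₁ (suc n) (suc k) ≡ through₁ (suc (suc n)) (suc k)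
  through₁-pascal n zero    = refl
  through₁-pascal n (suc k) = nCk+nC[k+1]≡[n+1]C[k+1] n k

  through₂-pascal : ∀ n k → through₂ (suc (suc n)) k + through₂ (suc (suc n)) (suc k) ≡ through₂ (suc (suc (suc n))) (suc k)
  through₂-pascal n zero          = refl
  through₂-pascal n (suc zero)    = refl
  through₂-pascal n (suc (suc k)) = nCk+nC[k+1]≡[n+1]C[k+1] n k

  through₂-through₁ : ∀ n k → through₂ (suc (suc n)) (suc k) ≡ through₁ (suc n) k
  through₂-through₁ n zero    = refl
  through₂-through₁ n (suc k) = refl

  #subsetsOfSize : ∀ n k → ∑[ _ ∈ subsetsOfSize n k ] 1 ≡ n C k
  #subsetsOfSize zero    zero    = refl
  #subsetsOfSize zero    (suc k) = refl
  #subsetsOfSize (suc n) zero    = trans (∑-subsetsOfSize-suc₀ n (λ _ → 1)) (#subsetsOfSize n zero)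
  #subsetsOfSize (suc n) (suc k) =
    trans (∑-subsetsOfSize-suc n k (λ _ → 1))
          (trans (cong₂ _+_ (#subsetsOfSize n k) (#subsetsOfSize n (suc k))) (nCk+nC[k+1]≡[n+1]C[k+1] n k))

  length-subsetsOfSize : ∀ n k → length (subsetsOfSize n k) ≡ n C k
  length-subsetsOfSize n k = trans (length≡∑ (subsetsOfSize n k)) (#subsetsOfSize n k)

  [_∈_] : {n : ℕ} → Fin n → Subset n → ℕ
  [ i ∈ S ] = 𝟙 (i ∈ᵇ S)

  #through₁ : ∀ n k (i : Fin n) → ∑[ S ∈ subsetsOfSize n k ] [ i ∈ S ] ≡ through₁ n k
  #through₁ (suc n) zero    F.zero    = trans (∑-subsetsOfSize-suc₀ n _) (∑-zero (subsetsOfSize n zero))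
  #through₁ (suc n) zero    (F.suc i) = trans (∑-subsetsOfSize-suc₀ n _) (#through₁ n zero i)
  #through₁ (suc n) (suc k) F.zero    =
    trans (∑-subsetsOfSize-suc n k _)
          (trans (cong₂ _+_ (#subsetsOfSize n k) (∑-zero (subsetsOfSize n (suc k)))) (+-identityʳ (n C k)))
  #through₁ (suc (suc n)) (suc k) (F.suc i) =
    trans (∑-subsetsOfSize-suc (suc n) k _)
          (trans (cong₂ _+_ (#through₁ (suc n) k i) (#through₁ (suc n) (suc k) i)) (through₁-pascal n k))

  #through₂-zero : ∀ n k (i : Fin (suc n)) →
    ∑[ S ∈ subsetsOfSize (suc (suc n)) k ] ([ F.zero ∈ S ] * [ F.suc i ∈ S ]) ≡ through₂ (suc (suc n)) k
  #through₂-zero n zero    i = trans (∑-subsetsOfSize-suc₀ (suc n) _) (∑-zero (subsetsOfSize (suc n) zero))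
  #through₂-zero n (suc k) i =
    trans (∑-subsetsOfSize-suc (suc n) k _)
          (trans (cong₂ _+_ (trans (∑-cong (subsetsOfSize (suc n) k) (λ S → *-identityˡ [ i ∈ S ])) (#through₁ (suc n) k i))
                            (∑-zero (subsetsOfSize (suc n) (suc k))))
                 (trans (+-identityʳ _) (sym (through₂-through₁ n k))))

  #through₂ : ∀ n k (i i' : Fin n) → ¬ i ≡ i' → ∑[ S ∈ subsetsOfSize n k ] ([ i ∈ S ] * [ i' ∈ S ]) ≡ through₂ n k
  #through₂ n k F.zero F.zero i≢i' = ⊥-elim (i≢i' refl)
  #through₂ (suc (suc n)) k F.zero (F.suc i') _ = #through₂-zero n k i'
  #through₂ (suc (suc n)) k (F.suc i) F.zero _ =
    trans (∑-cong (subsetsOfSize (suc (suc n)) k) (λ S → *-comm [ F.suc i ∈ S ] [ F.zero ∈ S ])) (#through₂-zero n k i)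
  #through₂ (suc (suc zero)) k (F.suc F.zero) (F.suc F.zero) i≢i' = ⊥-elim (i≢i' refl)
  #through₂ (suc (suc (suc n))) zero (F.suc i) (F.suc i') i≢i' =
    trans (∑-subsetsOfSize-suc₀ (suc (suc n)) _) (#through₂ (suc (suc n)) zero i i' (λ e → i≢i' (cong F.suc e)))
  #through₂ (suc (suc (suc n))) (suc k) (F.suc i) (F.suc i') i≢i' =
    trans (∑-subsetsOfSize-suc (suc (suc n)) k _)
          (trans (cong₂ _+_ (#through₂ (suc (suc n)) k i i' i≢i'') (#through₂ (suc (suc n)) (suc k) i i' i≢i''))
                 (through₂-pascal n k))
    where
    i≢i'' : ¬ i ≡ i'
    i≢i'' e = i≢i' (cong F.suc e)

  absorption : ∀ n k → suc k * (suc n C suc k) ≡ suc n * (n C k)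
  absorption zero    zero    = refl
  absorption zero    (suc k) = *-zeroʳ (suc (suc k))
  absorption (suc n) zero    = trans (+-identityʳ _) (trans (nC1≡n (suc (suc n))) (sym (*-identityʳ (suc (suc n)))))
  absorption (suc n) (suc k) = begin
    suc (suc k) * (suc (suc n) C suc (suc k))
      ≡⟨ cong (suc (suc k) *_) (nCk+nC[k+1]≡[n+1]C[k+1] (suc n) (suc k)) ⟨
    suc (suc k) * (suc n C suc k + suc n C suc (suc k))
      ≡⟨ expand (suc k) (suc n C suc k) (suc n C suc (suc k)) ⟩
    suc k * (suc n C suc k) + suc n C suc k + suc (suc k) * (suc n C suc (suc k))
      ≡⟨ cong₂ _+_ (cong₂ _+_ (absorption n k) (sym (nCk+nC[k+1]≡[n+1]C[k+1] n k))) (absorption n (suc k)) ⟩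
    suc n * (n C k) + (n C k + n C suc k) + suc n * (n C suc k)
      ≡⟨ collect (suc n) (n C k) (n C suc k) ⟩
    suc (suc n) * (n C k + n C suc k)
      ≡⟨ cong (suc (suc n) *_) (nCk+nC[k+1]≡[n+1]C[k+1] n k) ⟩
    suc (suc n) * (suc n C suc k) ∎
    where
    open ≡-Reasoning
    expand : ∀ a x y → suc a * (x + y) ≡ a * x + x + suc a * y
    expand = solve-∀
    collect : ∀ a x y → a * x + (x + y) + a * y ≡ suc a * (x + y)
    collect = solve-∀

  size*subsets : ∀ n k → k * (n C k) ≡ n * through₁ n k
  size*subsets n       zero    = sym (*-zeroʳ n)
  size*subsets zero    (suc k) = *-zeroʳ (suc k)
  size*subsets (suc n) (suc k) = absorption n k

  through₂≤through₁ : ∀ n k → n * through₂ n k ≤ k * through₁ n k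
  through₂≤through₁ n             zero          = ≤-reflexive (*-zeroʳ n)
  through₂≤through₁ n             (suc zero)    = ≤-trans (≤-reflexive (*-zeroʳ n)) z≤n
  through₂≤through₁ zero          (suc (suc k)) = z≤n
  through₂≤through₁ (suc zero)    (suc (suc k)) = z≤n
  through₂≤through₁ (suc (suc n)) (suc (suc k)) = begin
    suc (suc n) * (n C k)                     ≡⟨ cong (n C k +_) (absorption n k) ⟨
    n C k + suc k * (suc n C suc k)           ≤⟨ +-monoˡ-≤ _ (≤-trans (m≤m+n (n C k) (n C suc k)) (≤-reflexive (nCk+nC[k+1]≡[n+1]C[k+1] n k))) ⟩
    (suc n C suc k) + suc k * (suc n C suc k) ∎
    where open ≤-Reasoning

  #through-pair≤ : ∀ n k (i i' : Fin n) →
    ∑[ S ∈ subsetsOfSize n k ] ([ i ∈ S ] * [ i' ∈ S ]) ≤ δ i i' * through₁ n k + through₂ n k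
  #through-pair≤ n k i i' with i FP.≟ i'
  ... | yes refl = begin
    ∑[ S ∈ subsetsOfSize n k ] ([ i ∈ S ] * [ i ∈ S ]) ≡⟨ ∑-cong (subsetsOfSize n k) (λ S → 𝟙-idem (i ∈ᵇ S)) ⟩
    ∑[ S ∈ subsetsOfSize n k ] [ i ∈ S ]                ≡⟨ #through₁ n k i ⟩
    through₁ n k                                        ≡⟨ *-identityˡ (through₁ n k) ⟨
    1 * through₁ n k                                     ≤⟨ m≤m+n _ (through₂ n k) ⟩
    1 * through₁ n k + through₂ n k                      ∎
    where open ≤-Reasoning
  ... | no i≢i' = ≤-reflexive (#through₂ n k i i' i≢i')


module Arithmetic where

  open import Data.Nat using (ℕ; zero; suc; _+_; _*_; _∸_; _≤_; NonZero; >-nonZero)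
  open import Data.Nat.Properties
  open import Data.Nat.Tactic.RingSolver using (solve-∀)
  open import Data.Sum using (inj₁; inj₂)
  open import Relation.Binary.PropositionalEquality
  open import Relation.Nullary using (contradiction)

  -- 2kℓ ≤ k² + ℓ², checked by writing the larger number as the smaller plus m.
  2kℓ≤k²+ℓ² : ∀ k ℓ → 2 * (k * ℓ) ≤ k * k + ℓ * ℓ
  2kℓ≤k²+ℓ² k ℓ with ≤-total k ℓ
  ... | inj₁ k≤ℓ with ℓ ∸ k | m+[n∸m]≡n k≤ℓ
  ...   | m | refl = ≤-trans (m≤m+n _ (m * m)) (≤-reflexive (square k m))
    where
    square : ∀ k m → 2 * (k * (k + m)) + m * m ≡ k * k + (k + m) * (k + m)
    square = solve-∀
  2kℓ≤k²+ℓ² k ℓ | inj₂ ℓ≤k with k ∸ ℓ | m+[n∸m]≡n ℓ≤k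
  ...   | m | refl = ≤-trans (m≤m+n _ (m * m)) (≤-reflexive (square ℓ m))
    where
    square : ∀ ℓ m → 2 * ((ℓ + m) * ℓ) + m * m ≡ (ℓ + m) * (ℓ + m) + ℓ * ℓ
    square = solve-∀

  16qkℓ≤nN : ∀ n q N k ℓ → 16 * (k * k) * q ≤ n * N → 16 * (ℓ * ℓ) * q ≤ n * N → 16 * q * (k * ℓ) ≤ n * N
  16qkℓ≤nN n q N k ℓ k-small ℓ-small = *-cancelˡ-≤ 2 (begin
    2 * (16 * q * (k * ℓ))                  ≡⟨ e₁ q k ℓ ⟩
    16 * q * (2 * (k * ℓ))                  ≤⟨ *-monoʳ-≤ (16 * q) (2kℓ≤k²+ℓ² k ℓ) ⟩
    16 * q * (k * k + ℓ * ℓ)                ≡⟨ e₂ q k ℓ ⟩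
    16 * (k * k) * q + 16 * (ℓ * ℓ) * q     ≤⟨ +-mono-≤ k-small ℓ-small ⟩
    n * N + n * N                           ≡⟨ e₃ (n * N) ⟩
    2 * (n * N)                             ∎)
    where
    open ≤-Reasoning
    e₁ : ∀ q k ℓ → 2 * (16 * q * (k * ℓ)) ≡ 16 * q * (2 * (k * ℓ))
    e₁ = solve-∀
    e₂ : ∀ q k ℓ → 16 * q * (k * k + ℓ * ℓ) ≡ 16 * (k * k) * q + 16 * (ℓ * ℓ) * q
    e₂ = solve-∀
    e₃ : ∀ x → x + x ≡ 2 * x
    e₃ = solve-∀

  gap*kℓ≤N : ∀ n q N k ℓ → {{_ : NonZero q}} → n ≤ q →
             16 * (k * k) * q ≤ n * N → 16 * (ℓ * ℓ) * q ≤ n * N → n * (k * ℓ) ≤ q * N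
  gap*kℓ≤N n q N k ℓ n≤q k-small ℓ-small = *-mono-≤ n≤q (*-cancelˡ-≤ (16 * q) {{m*n≢0 16 q}} (begin
    16 * q * (k * ℓ) ≤⟨ 16qkℓ≤nN n q N k ℓ k-small ℓ-small ⟩
    n * N            ≤⟨ *-monoˡ-≤ N n≤q ⟩
    q * N            ≤⟨ *-monoˡ-≤ N (m≤n*m q 16) ⟩
    16 * q * N       ∎))
    where open ≤-Reasoning

  small⇒N≢0 : ∀ n q N k → 1 ≤ k → 16 * (k * k) * suc q ≤ n * N → NonZero N
  small⇒N≢0 n q (suc N) k       _ _ = _
  small⇒N≢0 n q zero    (suc k) _ h = contradiction (subst (16 * (suc k * suc k) * suc q ≤_) (*-zeroʳ n) h) λ ()

  -- The fraction n/q stands for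
  -- the soundness gap ε, Q = 3M·a₁b₁ is the total number of queried edges
  -- over all question pairs, X the total number of violated ones and R the
  -- number of rejected question pairs.  The sizes k, ℓ ≤ √(εN)/4 make the
  -- collision terms of the second moment at most (9/16)·εQ, so that at least
  -- (23/32)·εQ violations survive as rejections; in particular εQ ≤ 3R.
  module MomentArithmetic
    (n q N M d k ℓ a₁ a₂ b₁ b₂ X R : ℕ) {{_ : NonZero N}}
    (k≥1 : 1 ≤ k) (ℓ≥1 : 1 ≤ ℓ)
    (k-small : 16 * (k * k) * q ≤ n * N) (ℓ-small : 16 * (ℓ * ℓ) * q ≤ n * N)
    (handshake : N * d ≡ M * 3)
    (clause-pairs : M * a₂ ≤ k * a₁) (variable-pairs : N * b₂ ≤ ℓ * b₁)
    (many-violations : n * (M * 3 * (a₁ * b₁)) ≤ q * X)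
    (moments : 2 * X + M * 3 * (a₁ * b₁) ≤ 2 * R + M * 3 * (a₁ * b₁ + 3 * (a₁ * b₂) + d * (a₂ * b₁) + M * 3 * (a₂ * b₂)))
    where

    open ≤-Reasoning

    Q : ℕ
    Q = M * 3 * (a₁ * b₁)

    -- The three collision terms: pairs of edges sharing a clause, sharing a
    -- variable, or sharing nothing but appearing together by chance.
    collisions : ℕ
    collisions = M * 3 * (3 * (a₁ * b₂)) + M * 3 * (d * (a₂ * b₁)) + M * 3 * (M * 3 * (a₂ * b₂))

    k-small′ : 16 * k * q ≤ n * N
    k-small′ = ≤-trans (*-monoˡ-≤ q (*-monoʳ-≤ 16 (m≤m*n k k {{>-nonZero k≥1}}))) k-small

    ℓ-small′ : 16 * ℓ * q ≤ n * N
    ℓ-small′ = ≤-trans (*-monoˡ-≤ q (*-monoʳ-≤ 16 (m≤m*n ℓ ℓ {{>-nonZero ℓ≥1}}))) ℓ-small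

    kℓ-small : 16 * q * (k * ℓ) ≤ n * N
    kℓ-small = 16qkℓ≤nN n q N k ℓ k-small ℓ-small

    Nbound : 9 * M * a₁ * b₁ * (n * N) ≡ N * (3 * n * Q)
    Nbound = e M a₁ b₁ n N
      where
      e : ∀ M a₁ b₁ n N → 9 * M * a₁ * b₁ * (n * N) ≡ N * (3 * n * (M * 3 * (a₁ * b₁)))
      e = solve-∀

    same-clause : 16 * q * (M * 3 * (3 * (a₁ * b₂))) ≤ 3 * n * Q
    same-clause = *-cancelˡ-≤ N (begin
      N * (16 * q * (M * 3 * (3 * (a₁ * b₂)))) ≡⟨ e₁ N q M a₁ b₂ ⟩
      9 * M * a₁ * q * 16 * (N * b₂)           ≤⟨ *-monoʳ-≤ (9 * M * a₁ * q * 16) variable-pairs ⟩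
      9 * M * a₁ * q * 16 * (ℓ * b₁)           ≡⟨ e₂ M a₁ q ℓ b₁ ⟩
      9 * M * a₁ * b₁ * (16 * ℓ * q)           ≤⟨ *-monoʳ-≤ (9 * M * a₁ * b₁) ℓ-small′ ⟩
      9 * M * a₁ * b₁ * (n * N)                ≡⟨ Nbound ⟩
      N * (3 * n * Q)                          ∎)
      where
      e₁ : ∀ N q M a₁ b₂ → N * (16 * q * (M * 3 * (3 * (a₁ * b₂)))) ≡ 9 * M * a₁ * q * 16 * (N * b₂)
      e₁ = solve-∀
      e₂ : ∀ M a₁ q ℓ b₁ → 9 * M * a₁ * q * 16 * (ℓ * b₁) ≡ 9 * M * a₁ * b₁ * (16 * ℓ * q)
      e₂ = solve-∀

    same-variable : 16 * q * (M * 3 * (d * (a₂ * b₁))) ≤ 3 * n * Q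
    same-variable = *-cancelˡ-≤ N (begin
      N * (16 * q * (M * 3 * (d * (a₂ * b₁)))) ≡⟨ e₁ N q M d a₂ b₁ ⟩
      48 * q * M * a₂ * b₁ * (N * d)           ≡⟨ cong (48 * q * M * a₂ * b₁ *_) handshake ⟩
      48 * q * M * a₂ * b₁ * (M * 3)           ≡⟨ e₂ q M a₂ b₁ ⟩
      144 * q * M * b₁ * (M * a₂)              ≤⟨ *-monoʳ-≤ (144 * q * M * b₁) clause-pairs ⟩
      144 * q * M * b₁ * (k * a₁)              ≡⟨ e₃ q M b₁ k a₁ ⟩
      9 * M * a₁ * b₁ * (16 * k * q)           ≤⟨ *-monoʳ-≤ (9 * M * a₁ * b₁) k-small′ ⟩
      9 * M * a₁ * b₁ * (n * N)                ≡⟨ Nbound ⟩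
      N * (3 * n * Q)                          ∎)
      where
      e₁ : ∀ N q M d a₂ b₁ → N * (16 * q * (M * 3 * (d * (a₂ * b₁)))) ≡ 48 * q * M * a₂ * b₁ * (N * d)
      e₁ = solve-∀
      e₂ : ∀ q M a₂ b₁ → 48 * q * M * a₂ * b₁ * (M * 3) ≡ 144 * q * M * b₁ * (M * a₂)
      e₂ = solve-∀
      e₃ : ∀ q M b₁ k a₁ → 144 * q * M * b₁ * (k * a₁) ≡ 9 * M * a₁ * b₁ * (16 * k * q)
      e₃ = solve-∀

    disjoint : 16 * q * (M * 3 * (M * 3 * (a₂ * b₂))) ≤ 3 * n * Q
    disjoint = *-cancelˡ-≤ N (begin
      N * (16 * q * (M * 3 * (M * 3 * (a₂ * b₂)))) ≡⟨ e₁ N q M a₂ b₂ ⟩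
      144 * q * M * ((M * a₂) * (N * b₂))          ≤⟨ *-monoʳ-≤ (144 * q * M) (*-mono-≤ clause-pairs variable-pairs) ⟩
      144 * q * M * ((k * a₁) * (ℓ * b₁))          ≡⟨ e₂ q M k a₁ ℓ b₁ ⟩
      9 * M * a₁ * b₁ * (16 * q * (k * ℓ))         ≤⟨ *-monoʳ-≤ (9 * M * a₁ * b₁) kℓ-small ⟩
      9 * M * a₁ * b₁ * (n * N)                    ≡⟨ Nbound ⟩
      N * (3 * n * Q)                              ∎)
      where
      e₁ : ∀ N q M a₂ b₂ → N * (16 * q * (M * 3 * (M * 3 * (a₂ * b₂)))) ≡ 144 * q * M * ((M * a₂) * (N * b₂))
      e₁ = solve-∀
      e₂ : ∀ q M k a₁ ℓ b₁ → 144 * q * M * ((k * a₁) * (ℓ * b₁)) ≡ 9 * M * a₁ * b₁ * (16 * q * (k * ℓ))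
      e₂ = solve-∀

    collisions-small : 16 * q * collisions ≤ 9 * n * Q
    collisions-small = begin
      16 * q * collisions
        ≡⟨ *-distribˡ-+ (16 * q) _ _ ⟩
      16 * q * (M * 3 * (3 * (a₁ * b₂)) + M * 3 * (d * (a₂ * b₁))) + 16 * q * (M * 3 * (M * 3 * (a₂ * b₂)))
        ≡⟨ cong (_+ 16 * q * (M * 3 * (M * 3 * (a₂ * b₂)))) (*-distribˡ-+ (16 * q) _ _) ⟩
      16 * q * (M * 3 * (3 * (a₁ * b₂))) + 16 * q * (M * 3 * (d * (a₂ * b₁))) + 16 * q * (M * 3 * (M * 3 * (a₂ * b₂)))
        ≤⟨ +-mono-≤ (+-mono-≤ same-clause same-variable) disjoint ⟩
      3 * n * Q + 3 * n * Q + 3 * n * Q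
        ≡⟨ e n Q ⟩
      9 * n * Q ∎
      where
      e : ∀ n Q → 3 * n * Q + 3 * n * Q + 3 * n * Q ≡ 9 * n * Q
      e = solve-∀

    violations≤rejections : 2 * X ≤ 2 * R + collisions
    violations≤rejections = +-cancelʳ-≤ Q (2 * X) (2 * R + collisions) (≤-trans moments (≤-reflexive (e R M a₁ b₁ a₂ b₂ d)))
      where
      e : ∀ R M a₁ b₁ a₂ b₂ d → 2 * R + M * 3 * (a₁ * b₁ + 3 * (a₁ * b₂) + d * (a₂ * b₁) + M * 3 * (a₂ * b₂))
            ≡ 2 * R + (M * 3 * (3 * (a₁ * b₂)) + M * 3 * (d * (a₂ * b₁)) + M * 3 * (M * 3 * (a₂ * b₂))) + M * 3 * (a₁ * b₁)
      e = solve-∀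

    many-rejections : 23 * (n * Q) ≤ 32 * (q * R)
    many-rejections = +-cancelʳ-≤ (9 * n * Q) (23 * (n * Q)) (32 * (q * R)) (begin
      23 * (n * Q) + 9 * n * Q   ≡⟨ e₁ n Q ⟩
      32 * (n * Q)               ≤⟨ *-monoʳ-≤ 32 many-violations ⟩
      32 * (q * X)               ≡⟨ e₂ q X ⟩
      16 * q * (2 * X)           ≤⟨ *-monoʳ-≤ (16 * q) violations≤rejections ⟩
      16 * q * (2 * R + collisions) ≡⟨ e₃ q R collisions ⟩
      32 * (q * R) + 16 * q * collisions ≤⟨ +-monoʳ-≤ (32 * (q * R)) collisions-small ⟩
      32 * (q * R) + 9 * n * Q   ∎)
      where
      e₁ : ∀ n Q → 23 * (n * Q) + 9 * n * Q ≡ 32 * (n * Q)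
      e₁ = solve-∀
      e₂ : ∀ q X → 32 * (q * X) ≡ 16 * q * (2 * X)
      e₂ = solve-∀
      e₃ : ∀ q R c → 16 * q * (2 * R + c) ≡ 32 * (q * R) + 16 * q * c
      e₃ = solve-∀

    rejections-dominate : n * Q ≤ 3 * (q * R)
    rejections-dominate = *-cancelˡ-≤ 32 (begin
      32 * (n * Q)         ≤⟨ *-monoˡ-≤ (n * Q) (m≤m+n 32 37) ⟩
      69 * (n * Q)         ≡⟨ *-assoc 3 23 (n * Q) ⟩
      3 * (23 * (n * Q))   ≤⟨ *-monoʳ-≤ 3 many-rejections ⟩
      3 * (32 * (q * R))   ≡⟨ e q R ⟩
      32 * (3 * (q * R))   ∎)
      where
      e : ∀ q R → 3 * (32 * (q * R)) ≡ 32 * (3 * (q * R))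
      e = solve-∀


module Moments where

  open import Data.Bool using (Bool; true; false; not; if_then_else_)
  open import Data.Nat using (ℕ; zero; suc; _+_; _*_; _≤_; z≤n; NonZero)
  open import Data.Nat.Properties
  open import Data.Nat.Tactic.RingSolver using (solve-∀)
  open import Data.Fin using (Fin)
  import Data.Fin as F
  import Data.Fin.Properties as FP
  open import Data.Fin.Subset using (Subset)
  open import Data.Vec using (replicate)
  open import Data.List using (List; allFin; cartesianProduct; length)
  open import Data.List.Properties using (length-tabulate)
  open import Data.Bool.ListAction using (all)
  open import Data.Product using (Σ; _,_; proj₁; proj₂)
  open import Data.Empty using (⊥-elim)
  open import Function using (id)
  open import Relation.Nullary using (¬_)
  open import Relation.Nullary.Decidable using (yes; no)
  open import Relation.Binary.PropositionalEquality
  open import Defs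
  open FiniteSums
  open SubsetCounts
  open Arithmetic
  open import Data.Nat.Combinatorics using (_C_)

  -- Rounding a randomised prover: if each point x is answered by a S x, depending
  -- on the k-subset S ∋ x it was asked with, then some deterministic answer
  -- α x does at least as well as the average, for every payoff F.
  derandomise : ∀ {n} (k : ℕ) {B : Set} (a : Subset n → Fin n → B) (F : Fin n → B → ℕ) →
    Σ (Fin n → B) λ α →
      ∑[ x ∈ allFin n ] ∑[ S ∈ subsetsOfSize n k ] ([ x ∈ S ] * F x (a S x)) ≤ through₁ n k * ∑[ x ∈ allFin n ] F x (α x)
  derandomise {n} k a F = α , ≤-trans (∑-mono (allFin n) best) (≤-reflexive (∑-*ˡ (through₁ n k) (allFin n) (λ x → F x (α x))))
    where
    choice : (x : Fin n) → Σ (Subset n) _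
    choice x = ∑≤count*max (subsetsOfSize n k) (x ∈ᵇ_) (λ S → F x (a S x)) (replicate n false)
    α : Fin n → _
    α x = a (proj₁ (choice x)) x
    best : ∀ x → ∑[ S ∈ subsetsOfSize n k ] ([ x ∈ S ] * F x (a S x)) ≤ through₁ n k * F x (α x)
    best x = ≤-trans (proj₂ (choice x)) (≤-reflexive (cong (_* F x (α x)) (#through₁ n k x)))

  -- The clause/variable incidence structure of a formula.  Its edges are the
  -- pairs (i , p): the variable at position p of clause i.  Sums over edges are
  -- written ∑ₑ.
  module Edges {N M : ℕ} (φ : Formula N M) where

    varAt : Fin M → Fin 3 → Fin N
    varAt i p = var (φ i p)

    ∑ₑ : (Fin M → Fin 3 → ℕ) → ℕ
    ∑ₑ f = ∑[ i ∈ allFin M ] ∑[ p ∈ allFin 3 ] f i p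

    ∑ₑ-cong : {f g : Fin M → Fin 3 → ℕ} → (∀ i p → f i p ≡ g i p) → ∑ₑ f ≡ ∑ₑ g
    ∑ₑ-cong f≡g = ∑-cong (allFin M) (λ i → ∑-cong (allFin 3) (f≡g i))

    ∑ₑ-mono : {f g : Fin M → Fin 3 → ℕ} → (∀ i p → f i p ≤ g i p) → ∑ₑ f ≤ ∑ₑ g
    ∑ₑ-mono f≤g = ∑-mono (allFin M) (λ i → ∑-mono (allFin 3) (f≤g i))

    ∑ₑ-+ : (f g : Fin M → Fin 3 → ℕ) → ∑ₑ (λ i p → f i p + g i p) ≡ ∑ₑ f + ∑ₑ g
    ∑ₑ-+ f g = trans (∑-cong (allFin M) (λ i → ∑-+ (allFin 3) (f i) (g i))) (∑-+ (allFin M) _ _)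

    ∑ₑ-*ˡ : (c : ℕ) (f : Fin M → Fin 3 → ℕ) → ∑ₑ (λ i p → c * f i p) ≡ c * ∑ₑ f
    ∑ₑ-*ˡ c f = trans (∑-cong (allFin M) (λ i → ∑-*ˡ c (allFin 3) (f i))) (∑-*ˡ c (allFin M) _)

    ∑ₑ-*ʳ : (c : ℕ) (f : Fin M → Fin 3 → ℕ) → ∑ₑ (λ i p → f i p * c) ≡ ∑ₑ f * c
    ∑ₑ-*ʳ c f = trans (∑-cong (allFin M) (λ i → ∑-*ʳ c (allFin 3) (f i))) (∑-*ʳ c (allFin M) _)

    ∑ₑ-const : (c : ℕ) → ∑ₑ (λ _ _ → c) ≡ M * 3 * c
    ∑ₑ-const c = begin
      ∑[ i ∈ allFin M ] ∑[ p ∈ allFin 3 ] c ≡⟨ ∑-cong (allFin M) (λ i → ∑-const c (allFin 3)) ⟩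
      ∑[ i ∈ allFin M ] (3 * c)              ≡⟨ ∑-const (3 * c) (allFin M) ⟩
      length (allFin M) * (3 * c)            ≡⟨ cong (_* (3 * c)) (length-tabulate {n = M} id) ⟩
      M * (3 * c)                            ≡⟨ *-assoc M 3 c ⟨
      M * 3 * c                              ∎
      where open ≡-Reasoning

    ∑ₑ-swap : {A : Set} (xs : List A) (f : A → Fin M → Fin 3 → ℕ) →
              ∑[ x ∈ xs ] ∑ₑ (f x) ≡ ∑ₑ (λ i p → ∑[ x ∈ xs ] f x i p)
    ∑ₑ-swap xs f = trans (∑-swap xs (allFin M) (λ x i → ∑[ p ∈ allFin 3 ] f x i p))
                         (∑-cong (allFin M) (λ i → ∑-swap xs (allFin 3) (λ x p → f x i p)))

    wins : Strategy₁ M → Strategy₂ N → ℕ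
    wins α β = ∑ₑ (λ i p → 𝟙 (Vφ φ i p (α i) (β (varAt i p))))

    accProb≡wins/edges : (α : Strategy₁ M) (β : Strategy₂ N) → accProb φ α β ≡ ratio (wins α β) (M * 3)
    accProb≡wins/edges α β = cong₂ ratio
      (trans (count≡∑ won (cartesianProduct (allFin M) (allFin 3))) (∑-cartesian (allFin M) (allFin 3) (λ e → 𝟙 (won e))))
      (trans (length≡∑ (cartesianProduct (allFin M) (allFin 3)))
             (trans (∑-cartesian (allFin M) (allFin 3) (λ _ → 1)) (trans (∑ₑ-const 1) (*-identityʳ (M * 3)))))
      where
      won = λ e → Vφ φ (proj₁ e) (proj₂ e) (α (proj₁ e)) (β (varAt (proj₁ e) (proj₂ e)))

    module _ (distinct : DistinctVars φ) where

      δ-varAt : ∀ i p p' → δ (varAt i p) (varAt i p') ≡ δ p p'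
      δ-varAt i p p' with p FP.≟ p' | varAt i p FP.≟ varAt i p'
      ... | yes _    | yes _ = refl
      ... | no _     | no _  = refl
      ... | yes refl | no v≢v = ⊥-elim (v≢v refl)
      ... | no p≢p'  | yes v≡v' = ⊥-elim (p≢p' (distinct i p p' v≡v'))

      occurrences : ∀ i j → ∑[ p ∈ allFin 3 ] δ (varAt i p) j ≡ 𝟙 (occurs φ i j)
      occurrences i j with varAt i F.zero FP.≟ j | varAt i (F.suc F.zero) FP.≟ j | varAt i (F.suc (F.suc F.zero)) FP.≟ j
      ... | yes e₀ | yes e₁ | _      = ⊥-elim (0≢1 (distinct i _ _ (trans e₀ (sym e₁))))
        where 0≢1 : ¬ F.zero ≡ F.suc F.zero
              0≢1 ()
      ... | yes e₀ | no _   | yes e₂ = ⊥-elim (0≢2 (distinct i _ _ (trans e₀ (sym e₂))))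
        where 0≢2 : ¬ F.zero ≡ F.suc (F.suc F.zero)
              0≢2 ()
      ... | no _   | yes e₁ | yes e₂ = ⊥-elim (1≢2 (distinct i _ _ (trans e₁ (sym e₂))))
        where 1≢2 : ¬ F.suc F.zero ≡ F.suc (F.suc F.zero)
              1≢2 ()
      ... | yes _ | no _  | no _  = refl
      ... | no _  | yes _ | no _  = refl
      ... | no _  | no _  | yes _ = refl
      ... | no _  | no _  | no _  = refl

      module _ {d : ℕ} (regular : Regular φ d) where

        degree : ∀ j → ∑ₑ (λ i p → δ (varAt i p) j) ≡ d
        degree j = trans (∑-cong (allFin M) (λ i → occurrences i j))
                         (trans (sym (count≡∑ (λ i → occurs φ i j) (allFin M))) (regular j))

        handshake : N * d ≡ M * 3
        handshake = begin
          N * d                                                    ≡⟨ cong (_* d) (length-tabulate {n = N} id) ⟨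
          length (allFin N) * d                                    ≡⟨ ∑-const d (allFin N) ⟨
          ∑[ j ∈ allFin N ] d                                      ≡⟨ ∑-cong (allFin N) (λ j → sym (degree j)) ⟩
          ∑[ j ∈ allFin N ] ∑ₑ (λ i p → δ (varAt i p) j)          ≡⟨ ∑ₑ-swap (allFin N) (λ j i p → δ (varAt i p) j) ⟩
          ∑ₑ (λ i p → ∑[ j ∈ allFin N ] δ (varAt i p) j)          ≡⟨ ∑ₑ-cong (λ i p → ∑-δ′ (varAt i p)) ⟩
          ∑ₑ (λ _ _ → 1)                                           ≡⟨ trans (∑ₑ-const 1) (*-identityʳ (M * 3)) ⟩
          M * 3                                                    ∎
          where
          open ≡-Reasoning
          ∑-δ′ : (j₀ : Fin N) → ∑[ j ∈ allFin N ] δ j₀ j ≡ 1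
          ∑-δ′ j₀ = trans (∑-cong (allFin N) (λ j → sym (*-identityʳ (δ j₀ j)))) (∑-δ N j₀ (λ _ → 1))

  module Birthday {N M : ℕ} (φ : Formula N M) (k ℓ : ℕ) (a : BStrategy₁ M) (b : BStrategy₂ N) where

    open Edges φ

    𝒮 : List (Subset M)
    𝒮 = subsetsOfSize M k

    𝒯 : List (Subset N)
    𝒯 = subsetsOfSize N ℓ

    ∑ST : (Subset M → Subset N → ℕ) → ℕ
    ∑ST f = ∑[ S ∈ 𝒮 ] ∑[ T ∈ 𝒯 ] f S T

    ∑ST-cong : {f g : Subset M → Subset N → ℕ} → (∀ S T → f S T ≡ g S T) → ∑ST f ≡ ∑ST g
    ∑ST-cong f≡g = ∑-cong 𝒮 (λ S → ∑-cong 𝒯 (f≡g S))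

    ∑ST-mono : {f g : Subset M → Subset N → ℕ} → (∀ S T → f S T ≤ g S T) → ∑ST f ≤ ∑ST g
    ∑ST-mono f≤g = ∑-mono 𝒮 (λ S → ∑-mono 𝒯 (f≤g S))

    ∑ST-+ : (f g : Subset M → Subset N → ℕ) → ∑ST (λ S T → f S T + g S T) ≡ ∑ST f + ∑ST g
    ∑ST-+ f g = trans (∑-cong 𝒮 (λ S → ∑-+ 𝒯 (f S) (g S))) (∑-+ 𝒮 _ _)

    ∑ST-*ˡ : (c : ℕ) (f : Subset M → Subset N → ℕ) → ∑ST (λ S T → c * f S T) ≡ c * ∑ST f
    ∑ST-*ˡ c f = trans (∑-cong 𝒮 (λ S → ∑-*ˡ c 𝒯 (f S))) (∑-*ˡ c 𝒮 _)

    ∑ST-∑ₑ : (f : Subset M → Subset N → Fin M → Fin 3 → ℕ) →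
             ∑ST (λ S T → ∑ₑ (f S T)) ≡ ∑ₑ (λ i p → ∑ST (λ S T → f S T i p))
    ∑ST-∑ₑ f = trans (∑-cong 𝒮 (λ S → ∑ₑ-swap 𝒯 (f S))) (∑ₑ-swap 𝒮 (λ S i p → ∑[ T ∈ 𝒯 ] f S T i p))

    ∑ST-product : (f : Subset M → ℕ) (g : Subset N → ℕ) → ∑ST (λ S T → f S * g T) ≡ ∑ 𝒮 f * ∑ 𝒯 g
    ∑ST-product = ∑-product 𝒮 𝒯

    a₁ a₂ b₁ b₂ : ℕ
    a₁ = through₁ M k
    a₂ = through₂ M k
    b₁ = through₁ N ℓ
    b₂ = through₂ N ℓ

    queried : Subset M → Subset N → Fin M → Fin 3 → ℕ
    queried S T i p = [ i ∈ S ] * [ varAt i p ∈ T ]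

    verdict : Subset M → Subset N → Fin M → Fin 3 → Bool
    verdict S T i p = Vφ φ i p (a S i) (b T (varAt i p))

    #queried #violated #satisfied rejects : Subset M → Subset N → ℕ
    #queried   S T = ∑ₑ (queried S T)
    #violated  S T = ∑ₑ (λ i p → queried S T i p * 𝟙 (not (verdict S T i p)))
    #satisfied S T = ∑ₑ (λ i p → queried S T i p * 𝟙 (verdict S T i p))
    rejects    S T = 𝟙 (not (bAccepts φ a b S T))

    accepting⇒unviolated : ∀ S T → bAccepts φ a b S T ≡ true → #violated S T ≡ 0
    accepting⇒unviolated S T = all⇒∑≡0 _ _ (allFin M) clause
      where
      clause : ∀ i → (if i ∈ᵇ S then all (λ p → if varAt i p ∈ᵇ T then verdict S T i p else true) (allFin 3) else true) ≡ true →
               ∑[ p ∈ allFin 3 ] (queried S T i p * 𝟙 (not (verdict S T i p))) ≡ 0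
      clause i checks with i ∈ᵇ S
      ... | false = ∑-zero (allFin 3)
      ... | true  = all⇒∑≡0 _ _ (allFin 3) edge checks
        where
        edge : ∀ p → (if varAt i p ∈ᵇ T then verdict S T i p else true) ≡ true →
               1 * [ varAt i p ∈ T ] * 𝟙 (not (verdict S T i p)) ≡ 0
        edge p check with varAt i p ∈ᵇ T | verdict S T i p
        ... | false | _    = refl
        ... | true  | true = refl

    violated≤queried : ∀ S T → #violated S T ≤ #queried S T
    violated≤queried S T = ∑ₑ-mono (λ i p → m*𝟙≤m (queried S T i p) (not (verdict S T i p)))
      where
      m*𝟙≤m : ∀ m c → m * 𝟙 c ≤ m
      m*𝟙≤m m true  = ≤-reflexive (*-identityʳ m)
      m*𝟙≤m m false = ≤-trans (≤-reflexive (*-zeroʳ m)) z≤n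

    violated+satisfied : ∀ S T → #violated S T + #satisfied S T ≡ #queried S T
    violated+satisfied S T =
      trans (sym (∑ₑ-+ (λ i p → queried S T i p * 𝟙 (not (verdict S T i p))) (λ i p → queried S T i p * 𝟙 (verdict S T i p))))
            (∑ₑ-cong (λ i p → split (queried S T i p) (verdict S T i p)))
      where
      split : ∀ m c → m * 𝟙 (not c) + m * 𝟙 c ≡ m
      split m true  = trans (cong (_+ m * 1) (*-zeroʳ m)) (*-identityʳ m)
      split m false = trans (cong (m * 1 +_) (*-zeroʳ m)) (trans (+-identityʳ _) (*-identityʳ m))

    -- The pointwise inequality behind the second-moment method: with x violated
    -- and y queried edges, 2x + y ≤ 2·[reject] + y², because x = 0 on
    -- acceptance and x ≤ y, 3y ≤ 2 + y² always.
    moment-pointwise : ∀ S T → 2 * #violated S T + #queried S T ≤ 2 * rejects S T + #queried S T * #queried S T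
    moment-pointwise S T with bAccepts φ a b S T in accepts
    ... | true rewrite accepting⇒unviolated S T accepts = y≤y² (#queried S T)
      where
      y≤y² : ∀ y → y ≤ y * y
      y≤y² zero    = z≤n
      y≤y² (suc y) = m≤m*n (suc y) (suc y)
    ... | false = ≤-trans (+-monoˡ-≤ (#queried S T) (*-monoʳ-≤ 2 (violated≤queried S T)))
                          (≤-trans (≤-reflexive (three (#queried S T))) (3y≤2+y² (#queried S T)))
      where
      three : ∀ y → 2 * y + y ≡ 3 * y
      three = solve-∀
      3y≤2+y² : ∀ y → 3 * y ≤ 2 + y * y
      3y≤2+y² zero                = z≤n
      3y≤2+y² (suc zero)          = ≤-refl
      3y≤2+y² (suc (suc zero))    = ≤-refl
      3y≤2+y² (suc (suc (suc m))) = ≤-trans (m≤m+n (3 * (3 + m)) (2 + 3 * m + m * m)) (≤-reflexive (expand m))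
        where
        expand : ∀ m → 3 * (3 + m) + (2 + 3 * m + m * m) ≡ 2 + (3 + m) * (3 + m)
        expand = solve-∀

    first-moment : ∑ST #queried ≡ M * 3 * (a₁ * b₁)
    first-moment = begin
      ∑ST #queried                                   ≡⟨ ∑ST-∑ₑ queried ⟩
      ∑ₑ (λ i p → ∑ST (λ S T → queried S T i p))   ≡⟨ ∑ₑ-cong edge ⟩
      ∑ₑ (λ _ _ → a₁ * b₁)                           ≡⟨ ∑ₑ-const (a₁ * b₁) ⟩
      M * 3 * (a₁ * b₁)                              ∎
      where
      open ≡-Reasoning
      edge : ∀ i p → ∑ST (λ S T → queried S T i p) ≡ a₁ * b₁
      edge i p = trans (∑ST-product (λ S → [ i ∈ S ]) (λ T → [ varAt i p ∈ T ]))
                       (cong₂ _*_ (#through₁ M k i) (#through₁ N ℓ (varAt i p)))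

    together : Fin M → Fin 3 → Fin M → Fin 3 → ℕ
    together i p i' p' = ∑ST (λ S T → queried S T i p * queried S T i' p')

    together-bound : ∀ i p i' p' →
      together i p i' p' ≤ (δ i i' * a₁ + a₂) * (δ (varAt i p) (varAt i' p') * b₁ + b₂)
    together-bound i p i' p' = begin
      ∑ST (λ S T → ([ i ∈ S ] * [ j ∈ T ]) * ([ i' ∈ S ] * [ j' ∈ T ]))
        ≡⟨ ∑ST-cong (λ S T → interchange [ i ∈ S ] [ j ∈ T ] [ i' ∈ S ] [ j' ∈ T ]) ⟩
      ∑ST (λ S T → ([ i ∈ S ] * [ i' ∈ S ]) * ([ j ∈ T ] * [ j' ∈ T ]))
        ≡⟨ ∑ST-product (λ S → [ i ∈ S ] * [ i' ∈ S ]) (λ T → [ j ∈ T ] * [ j' ∈ T ]) ⟩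
      ∑[ S ∈ 𝒮 ] ([ i ∈ S ] * [ i' ∈ S ]) * ∑[ T ∈ 𝒯 ] ([ j ∈ T ] * [ j' ∈ T ])
        ≤⟨ *-mono-≤ (#through-pair≤ M k i i') (#through-pair≤ N ℓ j j') ⟩
      (δ i i' * a₁ + a₂) * (δ j j' * b₁ + b₂) ∎
      where
      open ≤-Reasoning
      j = varAt i p
      j' = varAt i' p'
      interchange : ∀ x y z w → x * y * (z * w) ≡ x * z * (y * w)
      interchange = solve-∀

    module _ (distinct : DistinctVars φ) {d : ℕ} (regular : Regular φ d) where

      -- The four kinds of pairs of edges: equal, in the same clause, on the same
      -- variable, and neither; only the last kind is numerous.
      pairBound : Fin M → Fin 3 → Fin M → Fin 3 → ℕ
      pairBound i p i' p' = δ i i' * (δ p p' * (a₁ * b₁)) + δ i i' * (a₁ * b₂)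
                          + δ (varAt i p) (varAt i' p') * (a₂ * b₁) + a₂ * b₂

      together≤pairBound : ∀ i p i' p' → together i p i' p' ≤ pairBound i p i' p'
      together≤pairBound i p i' p' = ≤-trans (together-bound i p i' p') (≤-reflexive (begin
        (δ i i' * a₁ + a₂) * (δ j j' * b₁ + b₂)
          ≡⟨ expand (δ i i') (δ j j') a₁ a₂ b₁ b₂ ⟩
        δ i i' * δ j j' * (a₁ * b₁) + δ i i' * (a₁ * b₂) + δ j j' * (a₂ * b₁) + a₂ * b₂
          ≡⟨ cong (λ z → z * (a₁ * b₁) + δ i i' * (a₁ * b₂) + δ j j' * (a₂ * b₁) + a₂ * b₂) same-clause ⟩
        δ i i' * δ p p' * (a₁ * b₁) + δ i i' * (a₁ * b₂) + δ j j' * (a₂ * b₁) + a₂ * b₂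
          ≡⟨ cong (λ z → z + δ i i' * (a₁ * b₂) + δ j j' * (a₂ * b₁) + a₂ * b₂) (*-assoc (δ i i') (δ p p') (a₁ * b₁)) ⟩
        pairBound i p i' p' ∎))
        where
        open ≡-Reasoning
        j = varAt i p
        j' = varAt i' p'
        expand : ∀ x y a₁ a₂ b₁ b₂ → (x * a₁ + a₂) * (y * b₁ + b₂) ≡ x * y * (a₁ * b₁) + x * (a₁ * b₂) + y * (a₂ * b₁) + a₂ * b₂
        expand = solve-∀
        same-clause : δ i i' * δ j j' ≡ δ i i' * δ p p'
        same-clause with i FP.≟ i'
        ... | yes refl = cong (1 *_) (δ-varAt distinct i p p')
        ... | no _     = refl

      pairLoad : ℕ
      pairLoad = a₁ * b₁ + 3 * (a₁ * b₂) + d * (a₂ * b₁) + M * 3 * (a₂ * b₂)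

      ∑ₑ-pairBound : ∀ i p → ∑ₑ (pairBound i p) ≡ pairLoad
      ∑ₑ-pairBound i p = begin
        ∑ₑ (pairBound i p)
          ≡⟨ trans (∑ₑ-+ (λ i' p' → sameEdge i' p' + sameClause i' p' + sameVar i' p') (λ _ _ → a₂ * b₂))
                   (cong (_+ ∑ₑ (λ _ _ → a₂ * b₂)) (trans (∑ₑ-+ (λ i' p' → sameEdge i' p' + sameClause i' p') sameVar)
                                                            (cong (_+ ∑ₑ sameVar) (∑ₑ-+ sameEdge sameClause)))) ⟩
        ∑ₑ sameEdge + ∑ₑ sameClause + ∑ₑ sameVar + ∑ₑ (λ _ _ → a₂ * b₂)
          ≡⟨ cong₂ _+_ (cong₂ _+_ (cong₂ _+_ ∑-sameEdge ∑-sameClause) ∑-sameVar) (∑ₑ-const (a₂ * b₂)) ⟩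
        pairLoad ∎
        where
        open ≡-Reasoning
        sameEdge sameClause sameVar : Fin M → Fin 3 → ℕ
        sameEdge    i' p' = δ i i' * (δ p p' * (a₁ * b₁))
        sameClause   i' p' = δ i i' * (a₁ * b₂)
        sameVar i' p' = δ (varAt i p) (varAt i' p') * (a₂ * b₁)
        ∑-sameEdge : ∑ₑ sameEdge ≡ a₁ * b₁
        ∑-sameEdge = trans (∑-cong (allFin M) (λ i' → ∑-*ˡ (δ i i') (allFin 3) (λ p' → δ p p' * (a₁ * b₁))))
                        (trans (∑-δ M i _) (∑-δ 3 p (λ _ → a₁ * b₁)))
        ∑-sameClause : ∑ₑ sameClause ≡ 3 * (a₁ * b₂)
        ∑-sameClause = trans (∑-cong (allFin M) (λ i' → ∑-*ˡ (δ i i') (allFin 3) (λ _ → a₁ * b₂)))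
                         (trans (∑-δ M i _) (∑-const (a₁ * b₂) (allFin 3)))
        ∑-sameVar : ∑ₑ sameVar ≡ d * (a₂ * b₁)
        ∑-sameVar = trans (∑ₑ-cong (λ i' p' → cong (_* (a₂ * b₁)) (δ-sym (varAt i p) (varAt i' p'))))
                           (trans (∑ₑ-*ʳ (a₂ * b₁) (λ i' p' → δ (varAt i' p') (varAt i p)))
                                  (cong (_* (a₂ * b₁)) (degree distinct regular (varAt i p))))

      second-moment : ∑ST (λ S T → #queried S T * #queried S T) ≤ M * 3 * pairLoad
      second-moment = begin
        ∑ST (λ S T → #queried S T * #queried S T)
          ≡⟨ ∑ST-cong (λ S T → square (queried S T)) ⟩
        ∑ST (λ S T → ∑ₑ (λ i p → ∑ₑ (λ i' p' → queried S T i p * queried S T i' p')))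
          ≡⟨ ∑ST-∑ₑ (λ S T i p → ∑ₑ (λ i' p' → queried S T i p * queried S T i' p')) ⟩
        ∑ₑ (λ i p → ∑ST (λ S T → ∑ₑ (λ i' p' → queried S T i p * queried S T i' p')))
          ≡⟨ ∑ₑ-cong (λ i p → ∑ST-∑ₑ (λ S T i' p' → queried S T i p * queried S T i' p')) ⟩
        ∑ₑ (λ i p → ∑ₑ (together i p))
          ≤⟨ ∑ₑ-mono (λ i p → ∑ₑ-mono (together≤pairBound i p)) ⟩
        ∑ₑ (λ i p → ∑ₑ (pairBound i p))
          ≡⟨ trans (∑ₑ-cong ∑ₑ-pairBound) (∑ₑ-const pairLoad) ⟩
        M * 3 * pairLoad ∎
        where
        open ≤-Reasoning
        square : (f : Fin M → Fin 3 → ℕ) → ∑ₑ f * ∑ₑ f ≡ ∑ₑ (λ i p → ∑ₑ (λ i' p' → f i p * f i' p'))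
        square f = trans (sym (∑ₑ-*ʳ (∑ₑ f) f)) (∑ₑ-cong (λ i p → sym (∑ₑ-*ˡ (f i p) f)))

      -- Summing the pointwise inequality: violations force rejections unless the
      -- number of queried edges fluctuates.
      moment-inequality : 2 * ∑ST #violated + M * 3 * (a₁ * b₁) ≤ 2 * ∑ST rejects + M * 3 * pairLoad
      moment-inequality = begin
        2 * ∑ST #violated + M * 3 * (a₁ * b₁)
          ≡⟨ cong₂ _+_ (sym (∑ST-*ˡ 2 #violated)) (sym first-moment) ⟩
        ∑ST (λ S T → 2 * #violated S T) + ∑ST #queried
          ≡⟨ ∑ST-+ _ _ ⟨
        ∑ST (λ S T → 2 * #violated S T + #queried S T)
          ≤⟨ ∑ST-mono moment-pointwise ⟩
        ∑ST (λ S T → 2 * rejects S T + #queried S T * #queried S T)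
          ≡⟨ ∑ST-+ _ _ ⟩
        ∑ST (λ S T → 2 * rejects S T) + ∑ST (λ S T → #queried S T * #queried S T)
          ≤⟨ +-mono-≤ (≤-reflexive (∑ST-*ˡ 2 rejects)) second-moment ⟩
        2 * ∑ST rejects + M * 3 * pairLoad ∎
        where open ≤-Reasoning

    gain₁ : Fin M → ClauseAssignment → ℕ
    gain₁ i α = ∑[ p ∈ allFin 3 ] ∑[ T ∈ 𝒯 ] ([ varAt i p ∈ T ] * 𝟙 (Vφ φ i p α (b T (varAt i p))))

    satisfied-by-clause : ∑ST #satisfied ≡ ∑[ i ∈ allFin M ] ∑[ S ∈ 𝒮 ] ([ i ∈ S ] * gain₁ i (a S i))
    satisfied-by-clause = trans (∑ST-∑ₑ (λ S T i p → queried S T i p * 𝟙 (verdict S T i p)))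
                                (∑-cong (allFin M) clause)
      where
      clause : ∀ i → ∑[ p ∈ allFin 3 ] ∑ST (λ S T → queried S T i p * 𝟙 (verdict S T i p))
                   ≡ ∑[ S ∈ 𝒮 ] ([ i ∈ S ] * gain₁ i (a S i))
      clause i = trans (∑-swap (allFin 3) 𝒮 (λ p S → ∑[ T ∈ 𝒯 ] (queried S T i p * 𝟙 (verdict S T i p))))
                       (∑-cong 𝒮 (λ S → trans (∑-cong (allFin 3) (λ p → pull S p))
                                              (∑-*ˡ [ i ∈ S ] (allFin 3) (λ p → ∑[ T ∈ 𝒯 ] ([ varAt i p ∈ T ] * 𝟙 (verdict S T i p))))))
        where
        pull : ∀ S p → ∑[ T ∈ 𝒯 ] (queried S T i p * 𝟙 (verdict S T i p))
                     ≡ [ i ∈ S ] * ∑[ T ∈ 𝒯 ] ([ varAt i p ∈ T ] * 𝟙 (verdict S T i p))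
        pull S p = trans (∑-cong 𝒯 (λ T → *-assoc [ i ∈ S ] [ varAt i p ∈ T ] _)) (∑-*ˡ [ i ∈ S ] 𝒯 _)

    gain₂ : Strategy₁ M → Fin N → Bool → ℕ
    gain₂ α j β = ∑ₑ (λ i p → δ (varAt i p) j * 𝟙 (Vφ φ i p (α i) β))

    gain₁-by-variable : (α : Strategy₁ M) →
      ∑[ i ∈ allFin M ] gain₁ i (α i) ≡ ∑[ j ∈ allFin N ] ∑[ T ∈ 𝒯 ] ([ j ∈ T ] * gain₂ α j (b T j))
    gain₁-by-variable α = begin
      ∑ₑ (λ i p → ∑[ T ∈ 𝒯 ] ([ varAt i p ∈ T ] * won i p (b T (varAt i p))))
        ≡⟨ ∑ₑ-cong (λ i p → ∑-cong 𝒯 (λ T → sym (∑-δ N (varAt i p) (λ j → [ j ∈ T ] * won i p (b T j))))) ⟩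
      ∑ₑ (λ i p → ∑[ T ∈ 𝒯 ] ∑[ j ∈ allFin N ] (δ (varAt i p) j * ([ j ∈ T ] * won i p (b T j))))
        ≡⟨ ∑ₑ-swap 𝒯 (λ T i p → ∑[ j ∈ allFin N ] (δ (varAt i p) j * ([ j ∈ T ] * won i p (b T j)))) ⟨
      ∑[ T ∈ 𝒯 ] ∑ₑ (λ i p → ∑[ j ∈ allFin N ] (δ (varAt i p) j * ([ j ∈ T ] * won i p (b T j))))
        ≡⟨ ∑-cong 𝒯 (λ T → ∑ₑ-swap (allFin N) (λ j i p → δ (varAt i p) j * ([ j ∈ T ] * won i p (b T j)))) ⟨
      ∑[ T ∈ 𝒯 ] ∑[ j ∈ allFin N ] ∑ₑ (λ i p → δ (varAt i p) j * ([ j ∈ T ] * won i p (b T j)))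
        ≡⟨ ∑-cong 𝒯 (λ T → ∑-cong (allFin N) (λ j → pull T j)) ⟩
      ∑[ T ∈ 𝒯 ] ∑[ j ∈ allFin N ] ([ j ∈ T ] * gain₂ α j (b T j))
        ≡⟨ ∑-swap 𝒯 (allFin N) (λ T j → [ j ∈ T ] * gain₂ α j (b T j)) ⟩
      ∑[ j ∈ allFin N ] ∑[ T ∈ 𝒯 ] ([ j ∈ T ] * gain₂ α j (b T j)) ∎
      where
      open ≡-Reasoning
      won : Fin M → Fin 3 → Bool → ℕ
      won i p β = 𝟙 (Vφ φ i p (α i) β)
      pull : ∀ T j → ∑ₑ (λ i p → δ (varAt i p) j * ([ j ∈ T ] * won i p (b T j))) ≡ [ j ∈ T ] * gain₂ α j (b T j)
      pull T j = trans (∑ₑ-cong (λ i p → swap-factors (δ (varAt i p) j) [ j ∈ T ] (won i p (b T j))))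
                       (∑ₑ-*ˡ [ j ∈ T ] (λ i p → δ (varAt i p) j * won i p (b T j)))
        where
        swap-factors : ∀ x y z → x * (y * z) ≡ y * (x * z)
        swap-factors = solve-∀

    gain₂-wins : (α : Strategy₁ M) (β : Strategy₂ N) → ∑[ j ∈ allFin N ] gain₂ α j (β j) ≡ wins α β
    gain₂-wins α β = trans (∑ₑ-swap (allFin N) (λ j i p → δ (varAt i p) j * 𝟙 (Vφ φ i p (α i) (β j))))
                           (∑ₑ-cong (λ i p → ∑-δ N (varAt i p) (λ j → 𝟙 (Vφ φ i p (α i) (β j)))))

    -- Prover 1 is derandomised first,
    -- clause by clause, then prover 2, variable by variable.
    rounding : Σ (Strategy₁ M) λ α → Σ (Strategy₂ N) λ β → ∑ST #satisfied ≤ a₁ * (b₁ * wins α β)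
    rounding = α , β , (begin
      ∑ST #satisfied                                                   ≡⟨ satisfied-by-clause ⟩
      ∑[ i ∈ allFin M ] ∑[ S ∈ 𝒮 ] ([ i ∈ S ] * gain₁ i (a S i))       ≤⟨ proj₂ round₁ ⟩
      a₁ * ∑[ i ∈ allFin M ] gain₁ i (α i)                             ≡⟨ cong (a₁ *_) (gain₁-by-variable α) ⟩
      a₁ * ∑[ j ∈ allFin N ] ∑[ T ∈ 𝒯 ] ([ j ∈ T ] * gain₂ α j (b T j)) ≤⟨ *-monoʳ-≤ a₁ (proj₂ round₂) ⟩
      a₁ * (b₁ * ∑[ j ∈ allFin N ] gain₂ α j (β j))                    ≡⟨ cong (λ z → a₁ * (b₁ * z)) (gain₂-wins α β) ⟩
      a₁ * (b₁ * wins α β)                                             ∎)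
      where
      open ≤-Reasoning
      round₁ = derandomise k a gain₁
      α = proj₁ round₁
      round₂ = derandomise ℓ b (gain₂ α)
      β = proj₁ round₂

    accepts : Subset M → Subset N → ℕ
    accepts S T = 𝟙 (bAccepts φ a b S T)

    #questions : ℕ
    #questions = length 𝒮 * length 𝒯

    ∑ST-one : ∑ST (λ _ _ → 1) ≡ #questions
    ∑ST-one = trans (∑-cong 𝒮 (λ S → trans (∑-const 1 𝒯) (*-identityʳ (length 𝒯)))) (∑-const (length 𝒯) 𝒮)

    bAccProb≡accepts/questions : bAccProb φ k ℓ a b ≡ ratio (∑ST accepts) #questions
    bAccProb≡accepts/questions = cong₂ ratio
      (trans (count≡∑ _ (cartesianProduct 𝒮 𝒯)) (∑-cartesian 𝒮 𝒯 (λ ST → accepts (proj₁ ST) (proj₂ ST))))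
      (trans (length≡∑ (cartesianProduct 𝒮 𝒯)) (trans (∑-cartesian 𝒮 𝒯 (λ _ → 1)) ∑ST-one))

    accepts+rejects : ∑ST accepts + ∑ST rejects ≡ #questions
    accepts+rejects = trans (sym (∑ST-+ accepts rejects)) (trans (∑ST-cong (λ S T → 𝟙+𝟙-not (bAccepts φ a b S T))) ∑ST-one)
      where
      𝟙+𝟙-not : ∀ c → 𝟙 c + 𝟙 (not c) ≡ 1
      𝟙+𝟙-not true  = refl
      𝟙+𝟙-not false = refl

    queries-per-pair : N * (M * 3 * (a₁ * b₁)) ≡ 3 * (k * ℓ * #questions)
    queries-per-pair = begin
      N * (M * 3 * (a₁ * b₁))                        ≡⟨ e₁ N M a₁ b₁ ⟩
      3 * ((M * a₁) * (N * b₁))                      ≡⟨ cong₂ (λ x y → 3 * (x * y)) (size*subsets M k) (size*subsets N ℓ) ⟨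
      3 * ((k * (M C k)) * (ℓ * (N C ℓ)))            ≡⟨ cong₂ (λ x y → 3 * ((k * x) * (ℓ * y))) (length-subsetsOfSize M k) (length-subsetsOfSize N ℓ) ⟨
      3 * ((k * length 𝒮) * (ℓ * length 𝒯))          ≡⟨ e₂ k ℓ (length 𝒮) (length 𝒯) ⟩
      3 * (k * ℓ * #questions)                       ∎
      where
      open ≡-Reasoning
      e₁ : ∀ N M a₁ b₁ → N * (M * 3 * (a₁ * b₁)) ≡ 3 * ((M * a₁) * (N * b₁))
      e₁ = solve-∀
      e₂ : ∀ k ℓ x y → 3 * ((k * x) * (ℓ * y)) ≡ 3 * (k * ℓ * (x * y))
      e₂ = solve-∀

    many-violations : (n q : ℕ) → (∀ α β → q * wins α β + n * (M * 3) ≤ q * (M * 3)) →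
                      n * (M * 3 * (a₁ * b₁)) ≤ q * ∑ST #violated
    many-violations n q sound = +-cancelʳ-≤ (q * ∑ST #satisfied) _ _ (begin
      n * Q + q * ∑ST #satisfied             ≤⟨ +-monoʳ-≤ (n * Q) (*-monoʳ-≤ q round) ⟩
      n * Q + q * (a₁ * (b₁ * wins α β))     ≡⟨ e₁ n M a₁ b₁ q (wins α β) ⟩
      a₁ * b₁ * (q * wins α β + n * (M * 3)) ≤⟨ *-monoʳ-≤ (a₁ * b₁) (sound α β) ⟩
      a₁ * b₁ * (q * (M * 3))                ≡⟨ e₂ a₁ b₁ q M ⟩
      q * Q                                  ≡⟨ cong (q *_) (trans (sym first-moment) (∑ST-cong (λ S T → sym (violated+satisfied S T)))) ⟩
      q * ∑ST (λ S T → #violated S T + #satisfied S T) ≡⟨ cong (q *_) (∑ST-+ #violated #satisfied) ⟩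
      q * (∑ST #violated + ∑ST #satisfied)   ≡⟨ *-distribˡ-+ q _ _ ⟩
      q * ∑ST #violated + q * ∑ST #satisfied ∎)
      where
      open ≤-Reasoning
      Q = M * 3 * (a₁ * b₁)
      α = proj₁ rounding
      β = proj₁ (proj₂ rounding)
      round : ∑ST #satisfied ≤ a₁ * (b₁ * wins α β)
      round = proj₂ (proj₂ rounding)
      e₁ : ∀ n M a₁ b₁ q w → n * (M * 3 * (a₁ * b₁)) + q * (a₁ * (b₁ * w)) ≡ a₁ * b₁ * (q * w + n * (M * 3))
      e₁ = solve-∀
      e₂ : ∀ a₁ b₁ q M → a₁ * b₁ * (q * (M * 3)) ≡ q * (M * 3 * (a₁ * b₁))
      e₂ = solve-∀

  rejection-count :
    ∀ {N M d} (φ : Formula N M) → DistinctVars φ → Regular φ d → {{_ : NonZero N}} →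
    (n q : ℕ) → (∀ α β → q * Edges.wins φ α β + n * (M * 3) ≤ q * (M * 3)) →
    (k ℓ : ℕ) → 1 ≤ k → 1 ≤ ℓ → 16 * (k * k) * q ≤ n * N → 16 * (ℓ * ℓ) * q ≤ n * N →
    (a : BStrategy₁ M) (b : BStrategy₂ N) →
    let open Birthday φ k ℓ a b in n * (k * ℓ) * #questions ≤ q * (N * ∑ST rejects)
  rejection-count {N} {M} {d} φ distinct regular n q sound k ℓ k≥1 ℓ≥1 k-small ℓ-small a b =
    *-cancelˡ-≤ 3 (begin
      3 * (n * (k * ℓ) * #questions)   ≡⟨ e₁ n (k * ℓ) #questions ⟩
      n * (3 * (k * ℓ * #questions))   ≡⟨ cong (n *_) queries-per-pair ⟨
      n * (N * Q)                      ≡⟨ e₂ n N Q ⟩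
      N * (n * Q)                      ≤⟨ *-monoʳ-≤ N rejections-dominate ⟩
      N * (3 * (q * ∑ST rejects))      ≡⟨ e₃ N q (∑ST rejects) ⟩
      3 * (q * (N * ∑ST rejects))      ∎)
    where
    open Birthday φ k ℓ a b
    open Edges φ using (handshake)
    open ≤-Reasoning
    open MomentArithmetic n q N M d k ℓ a₁ a₂ b₁ b₂ (∑ST #violated) (∑ST rejects) k≥1 ℓ≥1 k-small ℓ-small
           (handshake distinct regular) (through₂≤through₁ M k) (through₂≤through₁ N ℓ)
           (many-violations n q sound) (moment-inequality distinct regular)
           using (Q; rejections-dominate)
    e₁ : ∀ n x y → 3 * (n * x * y) ≡ n * (3 * (x * y))
    e₁ = solve-∀
    e₂ : ∀ n N Q → n * (N * Q) ≡ N * (n * Q)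
    e₂ = solve-∀
    e₃ : ∀ N q R → N * (3 * (q * R)) ≡ 3 * (q * (N * R))
    e₃ = solve-∀


module Fractions where

  open import Data.Nat as ℕ using (ℕ; zero; suc)
  import Data.Nat.Properties as ℕP
  open import Data.Nat.Tactic.RingSolver using (solve-∀)
  open import Data.Integer as ℤ using (+_; -[1+_])
  import Data.Integer.Properties as ℤP
  open import Data.Rational using (ℚ; mkℚ; _/_; 0ℚ; 1ℚ; _≤_; _<_; _+_; _*_; _-_; -_; toℚᵘ)
  open import Data.Rational.Properties
    using (toℚᵘ-fromℚᵘ; toℚᵘ-injective; toℚᵘ-homo-+; toℚᵘ-homo-*; toℚᵘ-mono-≤; toℚᵘ-cancel-≤;
           normalize-coprime; drop-*<*; ≤-trans; ≤-reflexive; +-monoˡ-≤; +-assoc; +-inverseˡ; +-inverseʳ; +-identityʳ; +-identityˡ)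
  open import Data.Rational.Unnormalised as ℚᵘ using (mkℚᵘ; *≤*)
  import Data.Rational.Unnormalised.Properties as ℚᵘP
  open import Data.Product using (Σ; _,_)
  open import Data.Empty using (⊥-elim)
  open import Relation.Binary.PropositionalEquality
  open import Defs using (ratio) renaming (toℚ to toℚ′)

  -- Throughout, (+ a) / suc b is the fraction a/(b+1) of natural numbers.  Its
  -- unnormalised form is mkℚᵘ (+ a) b, which makes arithmetic computable.
  unnormalised : ∀ a b → toℚᵘ ((+ a) / suc b) ℚᵘ.≃ mkℚᵘ (+ a) b
  unnormalised a b = toℚᵘ-fromℚᵘ (mkℚᵘ (+ a) b)

  frac-+ : ∀ a b c d → (+ a) / suc b + (+ c) / suc d ≡ (+ (a ℕ.* suc d ℕ.+ c ℕ.* suc b)) / (suc b ℕ.* suc d)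
  frac-+ a b c d = toℚᵘ-injective (ℚᵘP.≃-trans (toℚᵘ-homo-+ ((+ a) / suc b) ((+ c) / suc d))
    (ℚᵘP.≃-trans (ℚᵘP.+-cong (unnormalised a b) (unnormalised c d))
    (ℚᵘP.≃-trans (ℚᵘP.≃-reflexive (cong (λ z → mkℚᵘ z (ℕ.pred (suc b ℕ.* suc d))) numerator))
                 (ℚᵘP.≃-sym (unnormalised (a ℕ.* suc d ℕ.+ c ℕ.* suc b) (ℕ.pred (suc b ℕ.* suc d)))))))
    where
    numerator : (+ a) ℤ.* (+ suc d) ℤ.+ (+ c) ℤ.* (+ suc b) ≡ + (a ℕ.* suc d ℕ.+ c ℕ.* suc b)
    numerator = trans (cong₂ ℤ._+_ (sym (ℤP.pos-* a (suc d))) (sym (ℤP.pos-* c (suc b))))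
                      (sym (ℤP.pos-+ (a ℕ.* suc d) (c ℕ.* suc b)))

  frac-* : ∀ a b c d → ((+ a) / suc b) * ((+ c) / suc d) ≡ (+ (a ℕ.* c)) / (suc b ℕ.* suc d)
  frac-* a b c d = toℚᵘ-injective (ℚᵘP.≃-trans (toℚᵘ-homo-* ((+ a) / suc b) ((+ c) / suc d))
    (ℚᵘP.≃-trans (ℚᵘP.*-cong (unnormalised a b) (unnormalised c d))
    (ℚᵘP.≃-trans (ℚᵘP.≃-reflexive (cong (λ z → mkℚᵘ z (ℕ.pred (suc b ℕ.* suc d))) (sym (ℤP.pos-* a c))))
                 (ℚᵘP.≃-sym (unnormalised (a ℕ.* c) (ℕ.pred (suc b ℕ.* suc d)))))))

  frac-≤ : ∀ a b c d → a ℕ.* suc d ℕ.≤ c ℕ.* suc b → (+ a) / suc b ≤ (+ c) / suc d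
  frac-≤ a b c d h = toℚᵘ-cancel-≤ (ℚᵘP.≤-respˡ-≃ (ℚᵘP.≃-sym (unnormalised a b)) (ℚᵘP.≤-respʳ-≃ (ℚᵘP.≃-sym (unnormalised c d))
    (*≤* (subst₂ ℤ._≤_ (ℤP.pos-* a (suc d)) (ℤP.pos-* c (suc b)) (ℤ.+≤+ h)))))

  frac-≤⁻ : ∀ a b c d → (+ a) / suc b ≤ (+ c) / suc d → a ℕ.* suc d ℕ.≤ c ℕ.* suc b
  frac-≤⁻ a b c d h with ℚᵘP.≤-respˡ-≃ (unnormalised a b) (ℚᵘP.≤-respʳ-≃ (unnormalised c d) (toℚᵘ-mono-≤ h))
  ... | *≤* h′ = ℤP.drop‿+≤+ (subst₂ ℤ._≤_ (sym (ℤP.pos-* a (suc d))) (sym (ℤP.pos-* c (suc b))) h′)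

  ≤1-⇒+≤1 : ∀ x y → x ≤ 1ℚ - y → x + y ≤ 1ℚ
  ≤1-⇒+≤1 x y h = ≤-trans (+-monoˡ-≤ y h) (≤-reflexive (trans (+-assoc 1ℚ (- y) y)
                    (trans (cong (λ z → 1ℚ + z) (+-inverseˡ y)) (+-identityʳ 1ℚ))))

  +≤1⇒≤1- : ∀ x y → x + y ≤ 1ℚ → x ≤ 1ℚ - y
  +≤1⇒≤1- x y h = ≤-trans (≤-reflexive (sym (trans (+-assoc x y (- y))
                    (trans (cong (λ z → x + z) (+-inverseʳ y)) (+-identityʳ x))))) (+-monoˡ-≤ (- y) h)

  positive-fraction : (ε : ℚ) → 0ℚ < ε → Σ ℕ λ n → Σ ℕ λ q′ → ε ≡ (+ n) / suc q′
  positive-fraction (mkℚ (+ n) q′ coprime) _ = n , q′ , sym (normalize-coprime coprime)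
  positive-fraction (mkℚ -[1+ m ] q′ _) ε>0 = ⊥-elim (ℤP.<⇒≱ 0<negative ℤ.-≤+)
    where
    0<negative : + 0 ℤ.< -[1+ m ]
    0<negative = subst₂ ℤ._<_ (ℤP.*-zeroˡ (+ suc q′)) (ℤP.*-identityʳ -[1+ m ]) (drop-*<* ε>0)

  -- "x/t ≤ 1 - n/q" means qx + nt ≤ qt (when t = 0 the ratio is 0 and we
  -- ask for x = 0).
  gap-in-ℕ : ∀ x t n q′ → ratio x t ≤ 1ℚ - (+ n) / suc q′ → (t ≡ 0 → x ≡ 0) →
             suc q′ ℕ.* x ℕ.+ n ℕ.* t ℕ.≤ suc q′ ℕ.* t
  gap-in-ℕ x zero n q′ _ t≡0⇒x≡0 rewrite t≡0⇒x≡0 refl | ℕP.*-zeroʳ q′ | ℕP.*-zeroʳ n = ℕ.z≤n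
  gap-in-ℕ x (suc t) n q′ h _ = subst₂ ℕ._≤_ (e₁ x q′ n t) (e₂ t q′)
    (frac-≤⁻ (x ℕ.* suc q′ ℕ.+ n ℕ.* suc t) _ 1 0 (subst (_≤ 1ℚ) (frac-+ x t n q′) (≤1-⇒+≤1 _ _ h)))
    where
    e₁ : ∀ x q′ n t → (x ℕ.* suc q′ ℕ.+ n ℕ.* suc t) ℕ.* 1 ≡ suc q′ ℕ.* x ℕ.+ n ℕ.* suc t
    e₁ = solve-∀
    e₂ : ∀ t q′ → 1 ℕ.* (suc t ℕ.* suc q′) ≡ suc q′ ℕ.* suc t
    e₂ = solve-∀

  gap≤1 : ∀ x t n q′ → ratio x t ≤ 1ℚ - (+ n) / suc q′ → n ℕ.≤ suc q′
  gap≤1 x t n q′ h = subst₂ ℕ._≤_ (ℕP.*-identityʳ n) (ℕP.*-identityˡ (suc q′))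
    (frac-≤⁻ n q′ 1 0 (subst (_≤ 1ℚ) (+-identityˡ ε) (≤1-⇒+≤1 0ℚ ε (≤-trans (ratio-nonneg t) h))))
    where
    ε = (+ n) / suc q′
    ratio-nonneg : ∀ t → 0ℚ ≤ ratio x t
    ratio-nonneg zero    = ≤-reflexive refl
    ratio-nonneg (suc t) = frac-≤ 0 0 x t ℕ.z≤n

  size-in-ℕ : ∀ x n q′ N → toℚ′ x ≤ ((+ n) / suc q′) * toℚ′ N → x ℕ.* suc q′ ℕ.≤ n ℕ.* N
  size-in-ℕ x n q′ N h = subst₂ ℕ._≤_ (cong (x ℕ.*_) (cong suc (ℕP.*-identityʳ q′))) (ℕP.*-identityʳ (n ℕ.* N))
    (frac-≤⁻ x 0 (n ℕ.* N) _ (subst (toℚ′ x ≤_) (frac-* n q′ N 0) h))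

  bound-from-ℕ : ∀ x t y s n q′ → x ℕ.* (suc q′ ℕ.* suc s) ℕ.+ n ℕ.* y ℕ.* suc t ℕ.≤ suc t ℕ.* (suc q′ ℕ.* suc s) →
                 (+ x) / suc t ≤ 1ℚ - ((+ n) / suc q′) * ((+ y) / suc s)
  bound-from-ℕ x t y s n q′ h = +≤1⇒≤1- _ _
    (subst (λ z → (+ x) / suc t + z ≤ 1ℚ) (sym (frac-* n q′ y s))
      (subst (_≤ 1ℚ) (sym (frac-+ x t (n ℕ.* y) _))
        (frac-≤ (x ℕ.* (suc q′ ℕ.* suc s) ℕ.+ n ℕ.* y ℕ.* suc t) _ 1 0 (subst₂ ℕ._≤_ (sym (ℕP.*-identityʳ _)) (sym (ℕP.*-identityˡ _)) h))))

  -- "x/L ≤ 1 - (n/q)(y/N)" from the counting bound n·y·L ≤ q·N·R, where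
  -- x + R = L (if L = 0 the ratio is 0 and only (n/q)(y/N) ≤ 1 is needed).
  ratio-bound : ∀ n q′ y N L x R → {{_ : ℕ.NonZero N}} → x ℕ.+ R ≡ L →
                n ℕ.* y ℕ.* L ℕ.≤ suc q′ ℕ.* (N ℕ.* R) → n ℕ.* y ℕ.≤ suc q′ ℕ.* N →
                ratio x L ≤ 1ℚ - ((+ n) / suc q′) * ratio y N
  ratio-bound n q′ y (suc N′) zero x R _ _ ny≤qN =
    bound-from-ℕ 0 0 y N′ n q′ (subst₂ ℕ._≤_ (e₁ (n ℕ.* y)) (sym (ℕP.*-identityˡ _)) ny≤qN)
    where
    e₁ : ∀ z → z ≡ z ℕ.* 1
    e₁ = solve-∀
  ratio-bound n q′ y (suc N′) (suc L′) x R x+R≡L counted _ = bound-from-ℕ x L′ y N′ n q′ (begin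
    x ℕ.* (suc q′ ℕ.* suc N′) ℕ.+ n ℕ.* y ℕ.* suc L′         ≤⟨ ℕP.+-monoʳ-≤ (x ℕ.* (suc q′ ℕ.* suc N′)) counted ⟩
    x ℕ.* (suc q′ ℕ.* suc N′) ℕ.+ suc q′ ℕ.* (suc N′ ℕ.* R) ≡⟨ e₁ x (suc q′) (suc N′) R ⟩
    (x ℕ.+ R) ℕ.* (suc q′ ℕ.* suc N′)                       ≡⟨ cong (ℕ._* (suc q′ ℕ.* suc N′)) x+R≡L ⟩
    suc L′ ℕ.* (suc q′ ℕ.* suc N′)                          ∎)
    where
    open ℕP.≤-Reasoning
    e₁ : ∀ x q N R → x ℕ.* (q ℕ.* N) ℕ.+ q ℕ.* (N ℕ.* R) ≡ (x ℕ.+ R) ℕ.* (q ℕ.* N)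
    e₁ = solve-∀



open import Defs
open import Data.Nat using (ℕ; _*_; _≥_)
open import Data.Rational using (ℚ; _≤_; _<_; _-_; 0ℚ; 1ℚ)
import Data.Rational as Q
open import Data.Product using (Σ; _×_)
open import Relation.Binary.PropositionalEquality using (_≡_)

open import Data.Nat as ℕ using (suc; _+_; NonZero)
open import Data.Integer using (+_)
open import Data.Fin using (Fin)
open import Data.List using (allFin)
open import Data.Product using (_,_)
open import Data.Bool using (true)
open import Relation.Binary.PropositionalEquality using (refl; subst; sym)
open FiniteSums using (∑)
open Arithmetic using (small⇒N≢0; gap*kℓ≤N)
open Moments using (module Edges; module Birthday; rejection-count)
open Fractions using (gap-in-ℕ; gap≤1; size-in-ℕ; ratio-bound; positive-fraction)

no-clauses : ∀ M (f : Fin M → ℕ) → M * 3 ≡ 0 → ∑ (allFin M) f ≡ 0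
no-clauses 0 f _ = refl

birthday-soundness : (n q′ : ℕ) → let ε = (+ n) Q./ suc q′ in
  (N M d : ℕ) (φ : Formula N M) → DistinctVars φ → Regular φ d →
  ((a : Strategy₁ M) (b : Strategy₂ N) → accProb φ a b ≤ 1ℚ - ε) →
  (k ℓ : ℕ) → k ≥ 1 → ℓ ≥ 1 →
  toℚ (16 * (k * k)) ≤ ε Q.* toℚ N →
  toℚ (16 * (ℓ * ℓ)) ≤ ε Q.* toℚ N →
  (a : BStrategy₁ M) (b : BStrategy₂ N) →
  bAccProb φ k ℓ a b ≤ 1ℚ - ε Q.* ratio (k * ℓ) N
birthday-soundness n q′ N M d φ distinct regular sound k ℓ k≥1 ℓ≥1 k-small ℓ-small a b =
  subst (_≤ 1ℚ - ε Q.* ratio (k * ℓ) N) (sym bAccProb≡accepts/questions)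
    (ratio-bound n q′ (k * ℓ) N #questions (∑ST accepts) (∑ST rejects) accepts+rejects rejections
                 (gap*kℓ≤N n q N k ℓ ε≤1 k-smallℕ ℓ-smallℕ))
  where
  open Edges φ using (wins; accProb≡wins/edges)
  open Birthday φ k ℓ a b
  ε = (+ n) Q./ suc q′
  q = suc q′
  k-smallℕ = size-in-ℕ (16 * (k * k)) n q′ N k-small
  ℓ-smallℕ = size-in-ℕ (16 * (ℓ * ℓ)) n q′ N ℓ-small
  instance
    N≢0 : NonZero N
    N≢0 = small⇒N≢0 n q′ N k k≥1 k-smallℕ
  sound-wins : ∀ α β → ratio (wins α β) (M * 3) ≤ 1ℚ - ε
  sound-wins α β = subst (_≤ 1ℚ - ε) (accProb≡wins/edges α β) (sound α β)
  sound-winsℕ : ∀ α β → q * wins α β + n * (M * 3) ℕ.≤ q * (M * 3)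
  sound-winsℕ α β = gap-in-ℕ (wins α β) (M * 3) n q′ (sound-wins α β) (no-clauses M _)
  rejections = rejection-count φ distinct regular n q sound-winsℕ k ℓ k≥1 ℓ≥1 k-smallℕ ℓ-smallℕ a b
  ε≤1 : n ℕ.≤ q
  ε≤1 = gap≤1 (wins α₀ β₀) (M * 3) n q′ (sound-wins α₀ β₀)
    where
    α₀ : Strategy₁ M
    α₀ _ _ = true
    β₀ : Strategy₂ N
    β₀ _ = true

lemma30 : (ε : ℚ) → 0ℚ < ε →
  Σ ℚ (λ c → 0ℚ < c ×
    ((N M d : ℕ) (φ : Formula N M) → DistinctVars φ → Regular φ d →
     ((a : Strategy₁ M) (b : Strategy₂ N) → accProb φ a b ≤ 1ℚ - ε) →
     (k ℓ : ℕ) → k ≥ 1 → ℓ ≥ 1 →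
     toℚ (16 * (k * k)) ≤ ε Q.* toℚ N →
     toℚ (16 * (ℓ * ℓ)) ≤ ε Q.* toℚ N →
     (a : BStrategy₁ M) (b : BStrategy₂ N) →
     bAccProb φ k ℓ a b ≤ 1ℚ - c Q.* ratio (k * ℓ) N))
lemma30 ε ε>0 with positive-fraction ε ε>0
... | n , q′ , refl = ε , ε>0 , birthday-soundness n q′
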